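{- Let $k=k(n)$ be a sequence of non-negative integers with $k=n^{o(1)}$ as $n\to\infty$. Then, as $n\to\infty$, $$m(n,k)\ge \mathrm{IndMat}(n,k)\ge n^{(1+o(1))\binom{n}{k}}.$$
   Context: $\mathcal{P}(n)$ is the power set of $[n]=\{1,\dots,n\}$, identified with the vertex set of the hypercube $Q_n$ (two sets adjacent iff their symmetric difference has size one). A family $\mathcal{F}\subseteq\mathcal{P}(n)$ shatters $S\subseteq[n]$ if for every $A\subseteq S$ there is $B\in\mathcal{F}$ with $B\cap S=A$; $\mathrm{VC}(\mathcal{F})$ is the maximum size of a shattered set. Write $\binom{n}{\le k}=\sum_{i=0}^k\binom{n}{i}$; $\mathcal{F}$ is maximal if $|\mathcal{F}|=\binom{n}{\le\mathrm{VC}(\mathcal{F})}$. $m(n,k)$ is the number of maximal families in $\mathcal{P}(n)$ with VC dimension $k$. An induced matching in a graph is a set of pairwise vertex-disjoint edges such that no edge of the graph joins endpoints of two different edges of the set. $\mathrm{IndMat}(n,k)$ is the number of induced matchings in $Q_n$ consisting of edges between the layers $\binom{[n]}{k}$ and $\binom{[n]}{k+1}$ (the sets of size $k$ and $k+1$). -}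

module Defs where

open import Data.Bool using (Bool; true; false; _∧_; _∨_; not; _xor_; if_then_else_)
open import Data.Nat using (ℕ; zero; suc; _+_; _≡ᵇ_; _⊔_)
open import Data.Nat.Combinatorics using (_C_)
open import Data.Vec using (Vec; []; _∷_; zipWith)
open import Data.List using (List; []; _∷_; _++_; map; length; filterᵇ; foldr; concatMap)
open import Data.Product using (_×_; _,_)
open import Data.Bool.ListAction using (all; any)

-- Vertices of Q_n / elements of P(n): subsets of [n] as characteristic vectors.
PSet : ℕ → Set
PSet n = Vec Bool n

allSets : (n : ℕ) → List (PSet n)
allSets zero = [] ∷ []
allSets (suc n) = map (false ∷_) (allSets n) ++ map (true ∷_) (allSets n)

size : ∀ {n} → PSet n → ℕ
size [] = 0
size (true ∷ xs) = suc (size xs)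
size (false ∷ xs) = size xs

eqSet : ∀ {n} → PSet n → PSet n → Bool
eqSet [] [] = true
eqSet (x ∷ xs) (y ∷ ys) = not (x xor y) ∧ eqSet xs ys

_∩ˢ_ : ∀ {n} → PSet n → PSet n → PSet n
_∩ˢ_ = zipWith _∧_

subsetᵇ : ∀ {n} → PSet n → PSet n → Bool
subsetᵇ [] [] = true
subsetᵇ (x ∷ xs) (y ∷ ys) = (not x ∨ y) ∧ subsetᵇ xs ys

adjacent : ∀ {n} → PSet n → PSet n → Bool
adjacent A B = size (zipWith _xor_ A B) ≡ᵇ 1

sublists : ∀ {a} {A : Set a} → List A → List (List A)
sublists [] = [] ∷ []
sublists (x ∷ xs) = sublists xs ++ map (x ∷_) (sublists xs)

count : ∀ {a} {A : Set a} → (A → Bool) → List A → ℕ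
count p xs = length (filterᵇ p xs)

-- Families F ⊆ P(n) are represented as repetition-free lists (sublists of allSets n).
Family : ℕ → Set
Family n = List (PSet n)

shatters : ∀ {n} → Family n → PSet n → Bool
shatters {n} F S =
  all (λ A → any (λ B → eqSet (B ∩ˢ S) A) F) (filterᵇ (λ A → subsetᵇ A S) (allSets n))

-- VC dimension: maximum size of a shattered set (0 for the empty family, which
-- shatters nothing; irrelevant here since an empty family is never maximal).
VC : ∀ {n} → Family n → ℕ
VC {n} F = foldr _⊔_ 0 (map size (filterᵇ (shatters F) (allSets n)))

binom≤ : ℕ → ℕ → ℕ
binom≤ n zero = n C 0
binom≤ n (suc k) = binom≤ n k + n C (suc k)

-- m(n,k): number of maximal families in P(n) with VC dimension k
m : ℕ → ℕ → ℕ
m n k = count (λ F → (VC F ≡ᵇ k) ∧ (length F ≡ᵇ binom≤ n k)) (sublists (allSets n))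

layerEdges : (n k : ℕ) → List (PSet n × PSet n)
layerEdges n k =
  concatMap (λ A → map (λ B → (A , B))
              (filterᵇ (λ B → (size B ≡ᵇ suc k) ∧ adjacent A B) (allSets n)))
            (filterᵇ (λ A → size A ≡ᵇ k) (allSets n))

compatible : ∀ {n} → PSet n × PSet n → PSet n × PSet n → Bool
compatible (A , B) (C , D) =
  not (eqSet A C ∨ eqSet A D ∨ eqSet B C ∨ eqSet B D
       ∨ adjacent A C ∨ adjacent A D ∨ adjacent B C ∨ adjacent B D)

pairwiseᵇ : ∀ {a} {A : Set a} → (A → A → Bool) → List A → Bool
pairwiseᵇ R [] = true
pairwiseᵇ R (x ∷ xs) = all (R x) xs ∧ pairwiseᵇ R xs

-- IndMat(n,k): number of induced matchings of Q_n (including the empty one)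
-- all of whose edges lie between layers k and k+1
IndMat : ℕ → ℕ → ℕ
IndMat n k = count (pairwiseᵇ compatible) (sublists (layerEdges n k))

-- An induced matching M between the layers k and k+1 determines the family F_M obtained from
-- the sets of size at most k by replacing the lower end of every edge of M by its upper end.
-- It has binom(n, ≤ k) members. A shattered set of size k+1 would be an upper end B whose lower
-- end A is again a trace B′ ∩ B; then B′ is an upper end adjacent to A, which inducedness
-- forbids. On the other hand a k-set containing no lower end (for nonempty M, a k-subset of an
-- upper end other than its lower end) is shattered. As M is recovered from F_M, IndMat ≤ m.
--
-- For the lower bound, split [n] into [n−t] and t further points: choosing for every k-subset a
-- of [n−t] one of the t further singletons u gives the induced matching {(a, a ∪ u)}, so
-- IndMat(n,k) ≥ t^C(n−t,k). With D = (k+1)(2r+1) and t = ⌊n/D⌋, Pascal's rule gives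
-- 2r·C(n,k) ≤ (2r+1)·C(n−t,k), and once (2D)^(2r+2) ≤ n, which holds eventually since
-- k = n^o(1), also n^(2r+1) ≤ t^(2r+2). Hence n^(2r·C(n,k)) ≤ t^((2r+2)·C(n−t,k)), and taking
-- square roots, n^(r·C(n,k)) ≤ IndMat(n,k)^(r+1).

module Submission where

open import Defs
open import Data.Bool using (Bool; true; false; _∧_; _∨_; not; _xor_; T)
open import Data.Bool.ListAction using (all)
import Data.Bool.Properties as Bool
open import Data.Bool.Properties using (T-∧)
open import Data.Empty using (⊥-elim)
open import Data.List
  using (List; []; _∷_; _++_; map; length; filter; filterᵇ; foldr; concatMap; cartesianProductWith)
open import Data.List.Properties
  using (length-++; length-map; length-removeAt′; filter-++; filter-none; ∷-injective)
open import Data.List.Membership.Propositional using (_∈_; _∉_; find; lose)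
open import Data.List.Membership.Propositional.Properties
  using (∈-++⁺ˡ; ∈-++⁺ʳ; ∈-++⁻; ∈-map⁺; ∈-map⁻; ∈-filter⁺; ∈-filter⁻; ∈-cartesianProductWith⁻)
open import Data.List.Relation.Binary.Subset.Propositional using (_⊆_)
open import Data.List.Relation.Unary.All as All using ([]; _∷_)
open import Data.List.Relation.Unary.All.Properties as All using (all⁺; all⁻)
open import Data.List.Relation.Unary.Any using (here; there; _─_)
open import Data.List.Relation.Unary.Any.Properties using (any⁺; any⁻)
open import Data.List.Relation.Unary.AllPairs using ([]; _∷_)
open import Data.List.Relation.Unary.Unique.Propositional using (Unique)
open import Data.List.Relation.Unary.Unique.Propositional.Properties
  using (++⁺; filter⁺; cartesianProductWith⁺; Unique[x∷xs]⇒x∉xs)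
open import Data.Nat
  using ( ℕ; zero; suc; pred; _+_; _*_; _^_; _∸_; _⊔_; _≤_; _<_; z≤n; s≤s; s≤s⁻¹
        ; _≡ᵇ_; _≤ᵇ_; _≤?_; _≟_; NonZero; >-nonZero)
open import Data.Nat.Combinatorics using (_C_; nCk+nC[k+1]≡[n+1]C[k+1]; nC1≡n)
open import Data.Nat.DivMod using (_/_; _%_; m≡m%n+[m/n]*n; m%n<n; m/n*n≤m; m≥n⇒m/n>0)
open import Data.Nat.Properties
open import Data.Nat.Tactic.RingSolver using (solve-∀)
open import Data.Product using (_×_; _,_; proj₁; proj₂; ∃-syntax; Σ-syntax)
open import Data.Product.Properties using (,-injectiveʳ) renaming (≡-dec to ×-≡-dec)
open import Data.Sum using (_⊎_; inj₁; inj₂)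
import Data.Vec as Vec
open import Data.Vec using ([]; _∷_; zipWith)
open import Data.Vec.Properties using (≡-dec; ∷-injectiveʳ; ++-injective)
open import Function using (id; _∘_; case_of_; Equivalence)
open import Relation.Binary using (DecidableEquality; tri<; tri≈; tri>)
open import Relation.Binary.PropositionalEquality
open import Relation.Nullary using (¬_; Dec; yes; no; does)
open import Relation.Nullary.Decidable
  using (T?; dec-true; dec-false; decidable-stable; ¬?; _×-dec_; _⊎-dec_)
open import Relation.Unary using (Decidable)

open Equivalence using (to; from)
open import Algebra.Properties.CommutativeSemigroup +-commutativeSemigroup using (interchange)
open import Algebra.Properties.CommutativeSemigroup *-commutativeSemigroup using (x∙yz≈y∙xz; x∙yz≈yx∙z)

ind : Bool → ℕ
ind true = 1
ind false = 0

module _ {a} {A : Set a} where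

  count-∷ : (p : A → Bool) (x : A) (xs : List A) → count p (x ∷ xs) ≡ ind (p x) + count p xs
  count-∷ p x xs with p x
  ... | true = refl
  ... | false = refl

  count-++ : (p : A → Bool) (xs ys : List A) → count p (xs ++ ys) ≡ count p xs + count p ys
  count-++ p xs ys = trans (cong length (filter-++ (T? ∘ p) xs ys)) (length-++ (filterᵇ p xs))

  count-map : ∀ {b} {B : Set b} (p : B → Bool) (f : A → B) (xs : List A) →
              count p (map f xs) ≡ count (p ∘ f) xs
  count-map p f [] = refl
  count-map p f (x ∷ xs) with p (f x)
  ... | true = cong suc (count-map p f xs)
  ... | false = count-map p f xs

  count-cong : {p q : A → Bool} → (∀ x → p x ≡ q x) → (xs : List A) → count p xs ≡ count q xs
  count-cong e [] = refl
  count-cong {p} {q} e (x ∷ xs) = begin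
    count p (x ∷ xs)          ≡⟨ count-∷ p x xs ⟩
    ind (p x) + count p xs    ≡⟨ cong₂ _+_ (cong ind (e x)) (count-cong e xs) ⟩
    ind (q x) + count q xs    ≡⟨ count-∷ q x xs ⟨
    count q (x ∷ xs)          ∎
    where open ≡-Reasoning

  count-split : (p q r : A → Bool) → (∀ x → ind (p x) ≡ ind (q x) + ind (r x)) →
                (xs : List A) → count p xs ≡ count q xs + count r xs
  count-split p q r e [] = refl
  count-split p q r e (x ∷ xs) = begin
    count p (x ∷ xs)                                     ≡⟨ count-∷ p x xs ⟩
    ind (p x) + count p xs                               ≡⟨ cong₂ _+_ (e x) (count-split p q r e xs) ⟩
    (ind (q x) + ind (r x)) + (count q xs + count r xs)  ≡⟨ interchange (ind (q x)) _ _ _ ⟩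
    (ind (q x) + count q xs) + (ind (r x) + count r xs)  ≡⟨ cong₂ _+_ (count-∷ q x xs) (count-∷ r x xs) ⟨
    count q (x ∷ xs) + count r (x ∷ xs)                  ∎
    where open ≡-Reasoning

  count-pointwise : (p q r s : A → Bool) → (∀ x → ind (p x) + ind (q x) ≡ ind (r x) + ind (s x)) →
                    (xs : List A) → count p xs + count q xs ≡ count r xs + count s xs
  count-pointwise p q r s e [] = refl
  count-pointwise p q r s e (x ∷ xs) = begin
    count p (x ∷ xs) + count q (x ∷ xs)
      ≡⟨ cong₂ _+_ (count-∷ p x xs) (count-∷ q x xs) ⟩
    (ind (p x) + count p xs) + (ind (q x) + count q xs)
      ≡⟨ interchange (ind (p x)) _ _ _ ⟩
    (ind (p x) + ind (q x)) + (count p xs + count q xs)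
      ≡⟨ cong₂ _+_ (e x) (count-pointwise p q r s e xs) ⟩
    (ind (r x) + ind (s x)) + (count r xs + count s xs)
      ≡⟨ interchange (ind (r x)) _ _ _ ⟨
    (ind (r x) + count r xs) + (ind (s x) + count s xs)
      ≡⟨ cong₂ _+_ (count-∷ r x xs) (count-∷ s x xs) ⟨
    count r (x ∷ xs) + count s (x ∷ xs) ∎
    where open ≡-Reasoning

does⁺ : ∀ {p} {P : Set p} (P? : Dec P) → P → T (does P?)
does⁺ P? p = subst T (sym (dec-true P? p)) _

does⁻ : ∀ {p} {P : Set p} (P? : Dec P) → T (does P?) → P
does⁻ (yes p) _ = p

count-none : ∀ {a} {A : Set a} (p : A → Bool) {xs : List A} → (∀ {x} → x ∈ xs → p x ≡ false) → count p xs ≡ 0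
count-none p {xs} none = cong length (filter-none (T? ∘ p) (All.tabulate λ x∈xs → subst T (none x∈xs)))

module _ {a} {A : Set a} (_≟_ : DecidableEquality A) where

  open import Data.List.Membership.DecPropositional _≟_ using (_∈?_)

  count-≟ : ∀ {y} {xs : List A} → Unique xs → y ∈ xs → count (λ x → does (x ≟ y)) xs ≡ 1
  count-≟ {y} (y∉xs ∷ _) (here refl) rewrite dec-true (y ≟ y) refl =
    cong suc (count-none _ λ {x} x∈xs → dec-false (x ≟ y) λ x≡y → All.lookup y∉xs x∈xs (sym x≡y))
  count-≟ {y} {x ∷ _} (x∉xs ∷ u) (there y∈xs) rewrite dec-false (x ≟ y) (All.lookup x∉xs y∈xs) =
    count-≟ u y∈xs

  count-∈ : {xs ys : List A} → Unique xs → Unique ys → ys ⊆ xs → count (λ x → does (x ∈? ys)) xs ≡ length ys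
  count-∈ {xs} {[]} _ _ _ = count-none _ {xs} λ _ → refl
  count-∈ {xs} {y ∷ ys} uxs (y∉ys ∷ uys) y∷ys⊆xs = begin
    count (λ x → does (x ∈? y ∷ ys)) xs                              ≡⟨ count-split _ _ _ split xs ⟩
    count (λ x → does (x ≟ y)) xs + count (λ x → does (x ∈? ys)) xs
      ≡⟨ cong₂ _+_ (count-≟ uxs (y∷ys⊆xs (here refl))) (count-∈ uxs uys (y∷ys⊆xs ∘ there)) ⟩
    suc (length ys)                                                  ∎
    where
    open ≡-Reasoning
    split : ∀ x → ind (does (x ∈? y ∷ ys)) ≡ ind (does (x ≟ y)) + ind (does (x ∈? ys))
    split x with x ≟ y
    ... | yes refl rewrite dec-false (x ∈? ys) (λ x∈ys → All.lookup y∉ys x∈ys refl) = refl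
    ... | no _ = refl

module _ {a} {A : Set a} where

  ∈-─ : ∀ {x z} {ys : List A} (x∈ys : x ∈ ys) → z ∈ ys → z ≢ x → z ∈ (ys ─ x∈ys)
  ∈-─ (here refl) (here refl) z≢x = ⊥-elim (z≢x refl)
  ∈-─ (here refl) (there z∈ys) _ = z∈ys
  ∈-─ (there x∈ys) (here refl) _ = here refl
  ∈-─ (there x∈ys) (there z∈ys) z≢x = there (∈-─ x∈ys z∈ys z≢x)

  Unique-⊆⇒length≤ : {xs ys : List A} → Unique xs → xs ⊆ ys → length xs ≤ length ys
  Unique-⊆⇒length≤ [] _ = z≤n
  Unique-⊆⇒length≤ {x ∷ xs} {ys} (x∉xs ∷ u) xs⊆ys = begin
    suc (length xs)           ≤⟨ s≤s (Unique-⊆⇒length≤ u xs⊆ys─x) ⟩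
    suc (length (ys ─ x∈ys))  ≡⟨ length-removeAt′ ys _ ⟨
    length ys                 ∎
    where
    open ≤-Reasoning
    x∈ys : x ∈ ys
    x∈ys = xs⊆ys (here refl)
    xs⊆ys─x : xs ⊆ (ys ─ x∈ys)
    xs⊆ys─x z∈xs = ∈-─ x∈ys (xs⊆ys (there z∈xs)) (λ z≡x → All.lookup x∉xs z∈xs (sym z≡x))

module _ {a b} {A : Set a} {B : Set b} where

  Unique-map : (f : A → B) {xs : List A} → Unique xs →
               (∀ {x y} → x ∈ xs → y ∈ xs → f x ≡ f y → x ≡ y) → Unique (map f xs)
  Unique-map f [] _ = []
  Unique-map f (x∉xs ∷ u) inj =
    All.map⁺ (All.tabulate λ y∈xs fx≡fy → All.lookup x∉xs y∈xs (inj (here refl) (there y∈xs) fx≡fy))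
    ∷ Unique-map f u (λ x∈xs y∈xs → inj (there x∈xs) (there y∈xs))

  length≤count : (f : A → B) (q : B → Bool) {xs : List A} {ys : List B} →
    Unique xs → (∀ {x} → x ∈ xs → f x ∈ ys × T (q (f x))) →
    (∀ {x y} → x ∈ xs → y ∈ xs → f x ≡ f y → x ≡ y) → length xs ≤ count q ys
  length≤count f q {xs} u into inj = subst (_≤ _) (length-map f xs)
    (Unique-⊆⇒length≤ (Unique-map f u inj) λ fx∈ → case ∈-map⁻ f fx∈ of λ where
      (x , x∈xs , refl) → let (fx∈ys , qfx) = into x∈xs in ∈-filter⁺ (T? ∘ q) fx∈ys qfx)

module _ {a} {A : Set a} where

  ∈-sublists-∷⁻ : ∀ x xs {ys} → ys ∈ sublists (x ∷ xs) →
                  ys ∈ sublists xs ⊎ Σ[ zs ∈ List A ] (ys ≡ x ∷ zs × zs ∈ sublists xs)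
  ∈-sublists-∷⁻ x xs ys∈ with ∈-++⁻ (sublists xs) ys∈
  ... | inj₁ ys∈xs = inj₁ ys∈xs
  ... | inj₂ ys∈x∷ with ∈-map⁻ (x ∷_) ys∈x∷
  ... | zs , zs∈ , refl = inj₂ (zs , refl , zs∈)

  sublists-⊆ : (xs : List A) {ys : List A} → ys ∈ sublists xs → ∀ {y : A} → y ∈ ys → y ∈ xs
  sublists-⊆ [] (here refl) ()
  sublists-⊆ (x ∷ xs) ys∈ {y} y∈ys with ∈-sublists-∷⁻ x xs ys∈
  ... | inj₁ ys∈xs = there (sublists-⊆ xs ys∈xs y∈ys)
  ... | inj₂ (zs , refl , zs∈) with y∈ys
  ...   | here refl = here refl
  ...   | there y∈zs = there (sublists-⊆ xs zs∈ y∈zs)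

  filter∈sublists : ∀ {p} {P : A → Set p} (P? : Decidable P) (xs : List A) → filter P? xs ∈ sublists xs
  filter∈sublists P? [] = here refl
  filter∈sublists P? (x ∷ xs) with P? x
  ... | yes _ = ∈-++⁺ʳ (sublists xs) (∈-map⁺ (x ∷_) (filter∈sublists P? xs))
  ... | no _ = ∈-++⁺ˡ (filter∈sublists P? xs)

  sublists-unique : {xs : List A} → Unique xs → Unique (sublists xs)
  sublists-unique [] = [] ∷ []
  sublists-unique {x ∷ xs} (x∉xs ∷ u) =
    ++⁺ (sublists-unique u) (Unique-map (x ∷_) (sublists-unique u) (λ _ _ → proj₂ ∘ ∷-injective)) disjoint
    where
    disjoint : ∀ {ys} → ¬ (ys ∈ sublists xs × ys ∈ map (x ∷_) (sublists xs))
    disjoint (ys∈ , x∷zs∈) with ∈-map⁻ (x ∷_) x∷zs∈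
    ... | _ , _ , refl = All.lookup x∉xs (sublists-⊆ xs ys∈ (here refl)) refl

  sublists-ext : {xs : List A} → Unique xs → ∀ {ys zs} → ys ∈ sublists xs → zs ∈ sublists xs →
                 ys ⊆ zs → zs ⊆ ys → ys ≡ zs
  sublists-ext {[]} _ (here refl) (here refl) _ _ = refl
  sublists-ext {x ∷ xs} ux@(_ ∷ u) ys∈ zs∈ ys⊆zs zs⊆ys
    with ∈-sublists-∷⁻ x xs ys∈ | ∈-sublists-∷⁻ x xs zs∈
  ... | inj₁ ys∈′ | inj₁ zs∈′ = sublists-ext u ys∈′ zs∈′ ys⊆zs zs⊆ys
  ... | inj₁ ys∈′ | inj₂ (_ , refl , _) = ⊥-elim (Unique[x∷xs]⇒x∉xs ux (sublists-⊆ xs ys∈′ (zs⊆ys (here refl))))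
  ... | inj₂ (_ , refl , _) | inj₁ zs∈′ = ⊥-elim (Unique[x∷xs]⇒x∉xs ux (sublists-⊆ xs zs∈′ (ys⊆zs (here refl))))
  ... | inj₂ (_ , refl , ys∈′) | inj₂ (_ , refl , zs∈′) =
    cong (x ∷_) (sublists-ext u ys∈′ zs∈′ (tail-⊆ ys∈′ ys⊆zs) (tail-⊆ zs∈′ zs⊆ys))
    where
    tail-⊆ : ∀ {vs ws} → vs ∈ sublists xs → x ∷ vs ⊆ x ∷ ws → vs ⊆ ws
    tail-⊆ vs∈ x∷vs⊆x∷ws v∈vs with x∷vs⊆x∷ws (there v∈vs)
    ... | here refl = ⊥-elim (Unique[x∷xs]⇒x∉xs ux (sublists-⊆ xs vs∈ v∈vs))
    ... | there v∈ws = v∈ws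

  pairwiseᵇ⁻ : {R : A → A → Bool} → (∀ {x y} → T (R x y) → T (R y x)) → {xs : List A} → T (pairwiseᵇ R xs) →
               ∀ {x y} → x ∈ xs → y ∈ xs → x ≢ y → T (R x y)
  pairwiseᵇ⁻ {R} R-sym {z ∷ xs} pw x∈ y∈ x≢y with to (T-∧ {all (R z) xs}) pw
  ... | all-z , pw-xs with x∈ | y∈
  ...   | here refl | here refl = ⊥-elim (x≢y refl)
  ...   | here refl | there y∈xs = All.lookup (all⁺ (R z) xs all-z) y∈xs
  ...   | there x∈xs | here refl = R-sym (All.lookup (all⁺ (R z) xs all-z) x∈xs)
  ...   | there x∈xs | there y∈xs = pairwiseᵇ⁻ R-sym pw-xs x∈xs y∈xs x≢y

  pairwiseᵇ⁺ : {R : A → A → Bool} {xs : List A} → Unique xs →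
               (∀ {x y} → x ∈ xs → y ∈ xs → x ≢ y → T (R x y)) → T (pairwiseᵇ R xs)
  pairwiseᵇ⁺ [] _ = _
  pairwiseᵇ⁺ {R} {x ∷ xs} (x∉xs ∷ u) R-on = from T-∧
    ( all⁻ (R x) (All.tabulate λ y∈xs → R-on (here refl) (there y∈xs) (All.lookup x∉xs y∈xs))
    , pairwiseᵇ⁺ u (λ y∈xs z∈xs → R-on (there y∈xs) (there z∈xs)))

  pairwiseᵇ⇒Unique : {R : A → A → Bool} → (∀ x → ¬ T (R x x)) → {xs : List A} →
                     T (pairwiseᵇ R xs) → Unique xs
  pairwiseᵇ⇒Unique irr {[]} _ = []
  pairwiseᵇ⇒Unique {R} irr {x ∷ xs} pw with to (T-∧ {all (R x) xs}) pw
  ... | all-x , pw-xs =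
    All.map (λ Rxy x≡y → irr x (subst (T ∘ R x) (sym x≡y) Rxy)) (all⁺ (R x) xs all-x)
    ∷ pairwiseᵇ⇒Unique irr pw-xs

foldr-⊔-≡ : ∀ {k} (xs : List ℕ) → (∀ {x} → x ∈ xs → x ≤ k) → k ∈ xs → foldr _⊔_ 0 xs ≡ k
foldr-⊔-≡ {k} xs bounded k∈xs = ≤-antisym (upper xs bounded) (lower xs k∈xs)
  where
  upper : ∀ ys → (∀ {x} → x ∈ ys → x ≤ k) → foldr _⊔_ 0 ys ≤ k
  upper [] _ = z≤n
  upper (y ∷ ys) b = ⊔-lub (b (here refl)) (upper ys (b ∘ there))
  lower : ∀ ys → k ∈ ys → k ≤ foldr _⊔_ 0 ys
  lower (y ∷ ys) (here refl) = m≤m⊔n y _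
  lower (y ∷ ys) (there k∈ys) = ≤-trans (lower ys k∈ys) (m≤n⊔m y _)

length-cartesianProductWith : ∀ {a b c} {A : Set a} {B : Set b} {C : Set c} (f : A → B → C)
  (xs : List A) (ys : List B) → length (cartesianProductWith f xs ys) ≡ length xs * length ys
length-cartesianProductWith f [] ys = refl
length-cartesianProductWith f (x ∷ xs) ys = begin
  length (map (f x) ys ++ cartesianProductWith f xs ys)  ≡⟨ length-++ (map (f x) ys) ⟩
  length (map (f x) ys) + length (cartesianProductWith f xs ys)
    ≡⟨ cong₂ _+_ (length-map (f x) ys) (length-cartesianProductWith f xs ys) ⟩
  length ys + length xs * length ys  ∎
  where open ≡-Reasoning

module _ {a b} {A : Set a} {B : Set b} (g : A → List B) where

  ∈-concatMap-,⁻ : ∀ {x y} (xs : List A) → (x , y) ∈ concatMap (λ x → map (x ,_) (g x)) xs → x ∈ xs × y ∈ g x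
  ∈-concatMap-,⁻ (x ∷ xs) xy∈ with ∈-++⁻ (map (x ,_) (g x)) xy∈
  ... | inj₂ xy∈xs = let x∈xs , y∈ = ∈-concatMap-,⁻ xs xy∈xs in there x∈xs , y∈
  ... | inj₁ xy∈x with ∈-map⁻ (x ,_) xy∈x
  ...   | _ , y∈ , refl = here refl , y∈

  ∈-concatMap-,⁺ : ∀ {x y} (xs : List A) → x ∈ xs → y ∈ g x → (x , y) ∈ concatMap (λ x → map (x ,_) (g x)) xs
  ∈-concatMap-,⁺ (x ∷ xs) (here refl) y∈ = ∈-++⁺ˡ (∈-map⁺ (x ,_) y∈)
  ∈-concatMap-,⁺ (x ∷ xs) (there x∈xs) y∈ = ∈-++⁺ʳ (map (x ,_) (g x)) (∈-concatMap-,⁺ xs x∈xs y∈)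

  Unique-concatMap-, : ∀ {xs} → Unique xs → (∀ x → Unique (g x)) →
                      Unique (concatMap (λ x → map (x ,_) (g x)) xs)
  Unique-concatMap-, [] _ = []
  Unique-concatMap-, {x ∷ xs} ux@(_ ∷ u) ug =
    ++⁺ (Unique-map (x ,_) (ug x) (λ _ _ → ,-injectiveʳ)) (Unique-concatMap-, u ug) disjoint
    where
    disjoint : ∀ {e} → ¬ (e ∈ map (x ,_) (g x) × e ∈ concatMap (λ x → map (x ,_) (g x)) xs)
    disjoint (e∈x , e∈xs) with ∈-map⁻ (x ,_) e∈x
    ... | _ , _ , refl = Unique[x∷xs]⇒x∉xs ux (proj₁ (∈-concatMap-,⁻ xs e∈xs))

_≟ˢ_ : ∀ {n} → DecidableEquality (PSet n)
_≟ˢ_ = ≡-dec Bool._≟_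

eqSet⇒≡ : ∀ {n} {A B : PSet n} → T (eqSet A B) → A ≡ B
eqSet⇒≡ {A = []} {[]} _ = refl
eqSet⇒≡ {A = true ∷ A} {true ∷ B} e = cong (true ∷_) (eqSet⇒≡ e)
eqSet⇒≡ {A = false ∷ A} {false ∷ B} e = cong (false ∷_) (eqSet⇒≡ e)

eqSet-refl : ∀ {n} (A : PSet n) → T (eqSet A A)
eqSet-refl [] = _
eqSet-refl (true ∷ A) = eqSet-refl A
eqSet-refl (false ∷ A) = eqSet-refl A

allSets-complete : ∀ {n} (A : PSet n) → A ∈ allSets n
allSets-complete [] = here refl
allSets-complete {suc n} (false ∷ A) = ∈-++⁺ˡ (∈-map⁺ (false ∷_) (allSets-complete A))
allSets-complete {suc n} (true ∷ A) = ∈-++⁺ʳ _ (∈-map⁺ (true ∷_) (allSets-complete A))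

allSets-unique : ∀ n → Unique (allSets n)
allSets-unique zero = [] ∷ []
allSets-unique (suc n) = ++⁺ (prefix false) (prefix true) disjoint
  where
  prefix : ∀ b → Unique (map (b ∷_) (allSets n))
  prefix b = Unique-map (b ∷_) (allSets-unique n) (λ _ _ → ∷-injectiveʳ)
  disjoint : ∀ {A} → ¬ (A ∈ map (false ∷_) (allSets n) × A ∈ map (true ∷_) (allSets n))
  disjoint (A∈₀ , A∈₁) with ∈-map⁻ (false ∷_) A∈₀ | ∈-map⁻ (true ∷_) A∈₁
  ... | _ , _ , refl | _ , _ , ()

count-size : ∀ n i → count (λ S → does (size S ≟ i)) (allSets n) ≡ n C i
count-size zero zero = refl
count-size zero (suc i) = refl
count-size (suc n) i = begin
  count (λ S → does (size S ≟ i)) (map (false ∷_) (allSets n) ++ map (true ∷_) (allSets n))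
    ≡⟨ count-++ _ (map (false ∷_) (allSets n)) _ ⟩
  count _ (map (false ∷_) (allSets n)) + count _ (map (true ∷_) (allSets n))
    ≡⟨ cong₂ _+_ (count-map _ (false ∷_) (allSets n)) (count-map _ (true ∷_) (allSets n)) ⟩
  count (λ S → does (size S ≟ i)) (allSets n) + count (λ S → does (suc (size S) ≟ i)) (allSets n)
    ≡⟨ cong (_+ count (λ S → does (suc (size S) ≟ i)) (allSets n)) (count-size n i) ⟩
  n C i + count (λ S → does (suc (size S) ≟ i)) (allSets n)
    ≡⟨ pascal i ⟩
  suc n C i ∎
  where
  open ≡-Reasoning
  pascal : ∀ i → n C i + count (λ S → does (suc (size S) ≟ i)) (allSets n) ≡ suc n C i
  pascal zero = cong (n C 0 +_) (count-none _ {allSets n} λ _ → refl)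
  pascal (suc j) = trans (cong (n C suc j +_) (count-size n j))
                         (trans (+-comm (n C suc j) (n C j)) (nCk+nC[k+1]≡[n+1]C[k+1] n j))

count-size≤ : ∀ n k → count (λ S → does (size S ≤? k)) (allSets n) ≡ binom≤ n k
count-size≤ n zero = trans (count-cong (λ S → ≤0≡≟0 (size S)) (allSets n)) (count-size n 0)
  where
  ≤0≡≟0 : ∀ s → does (s ≤? 0) ≡ does (s ≟ 0)
  ≤0≡≟0 zero = refl
  ≤0≡≟0 (suc s) = refl
count-size≤ n (suc k) = begin
  count (λ S → does (size S ≤? suc k)) (allSets n)
    ≡⟨ count-split _ _ _ (λ S → split (size S)) (allSets n) ⟩
  count (λ S → does (size S ≤? k)) (allSets n) + count (λ S → does (size S ≟ suc k)) (allSets n)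
    ≡⟨ cong₂ _+_ (count-size≤ n k) (count-size n (suc k)) ⟩
  binom≤ n (suc k) ∎
  where
  open ≡-Reasoning
  split : ∀ s → ind (does (s ≤? suc k)) ≡ ind (does (s ≤? k)) + ind (does (s ≟ suc k))
  split s with <-cmp s (suc k)
  ... | tri< s<k+1 _ _ rewrite dec-true (s ≤? suc k) (<⇒≤ s<k+1) | dec-true (s ≤? k) (≤-pred s<k+1)
                             | dec-false (s ≟ suc k) (<⇒≢ s<k+1) = refl
  ... | tri≈ _ refl _ rewrite dec-true (s ≤? suc k) ≤-refl | dec-false (s ≤? k) (<⇒≱ ≤-refl)
                            | dec-true (s ≟ suc k) refl = refl
  ... | tri> _ _ s>k+1 rewrite dec-false (s ≤? suc k) (<⇒≱ s>k+1) | dec-false (s ≤? k) (<⇒≱ (<⇒≤ s>k+1))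
                             | dec-false (s ≟ suc k) (>⇒≢ s>k+1) = refl

dist : ∀ {n} → PSet n → PSet n → ℕ
dist A B = size (zipWith _xor_ A B)

dist-comm : ∀ {n} (A B : PSet n) → dist A B ≡ dist B A
dist-comm [] [] = refl
dist-comm (true ∷ A) (true ∷ B) = dist-comm A B
dist-comm (false ∷ A) (false ∷ B) = dist-comm A B
dist-comm (true ∷ A) (false ∷ B) = cong suc (dist-comm A B)
dist-comm (false ∷ A) (true ∷ B) = cong suc (dist-comm A B)

dist-self : ∀ {n} (A : PSet n) → dist A A ≡ 0
dist-self [] = refl
dist-self (true ∷ A) = dist-self A
dist-self (false ∷ A) = dist-self A

dist≡0⇒≡ : ∀ {n} (A B : PSet n) → dist A B ≡ 0 → A ≡ B
dist≡0⇒≡ [] [] _ = refl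
dist≡0⇒≡ (true ∷ A) (true ∷ B) d≡0 = cong (true ∷_) (dist≡0⇒≡ A B d≡0)
dist≡0⇒≡ (false ∷ A) (false ∷ B) d≡0 = cong (false ∷_) (dist≡0⇒≡ A B d≡0)

1≤dist : ∀ {n} (X Y : PSet n) → X ≢ Y → 1 ≤ dist X Y
1≤dist X Y X≢Y with dist X Y in d
... | zero = ⊥-elim (X≢Y (dist≡0⇒≡ X Y d))
... | suc _ = s≤s z≤n

2≤dist⇒≢ : ∀ {n} (X Y : PSet n) → 2 ≤ dist X Y → X ≢ Y
2≤dist⇒≢ X _ 2≤d refl = <⇒≱ 2≤d (≤-trans (≤-reflexive (dist-self X)) z≤n)

infix 4 _⊆ˢ_

_⊆ˢ_ : ∀ {n} → PSet n → PSet n → Set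
A ⊆ˢ B = T (subsetᵇ A B)

⊆ˢ-refl : ∀ {n} (A : PSet n) → A ⊆ˢ A
⊆ˢ-refl [] = _
⊆ˢ-refl (true ∷ A) = ⊆ˢ-refl A
⊆ˢ-refl (false ∷ A) = ⊆ˢ-refl A

size-mono : ∀ {n} (A B : PSet n) → A ⊆ˢ B → size A ≤ size B
size-mono [] [] _ = z≤n
size-mono (true ∷ A) (true ∷ B) A⊆B = s≤s (size-mono A B A⊆B)
size-mono (false ∷ A) (true ∷ B) A⊆B = m≤n⇒m≤1+n (size-mono A B A⊆B)
size-mono (false ∷ A) (false ∷ B) A⊆B = size-mono A B A⊆B

⊆ˢ-size⇒≡ : ∀ {n} (A B : PSet n) → A ⊆ˢ B → size B ≤ size A → A ≡ B
⊆ˢ-size⇒≡ [] [] _ _ = refl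
⊆ˢ-size⇒≡ (true ∷ A) (true ∷ B) A⊆B B≤A = cong (true ∷_) (⊆ˢ-size⇒≡ A B A⊆B (s≤s⁻¹ B≤A))
⊆ˢ-size⇒≡ (false ∷ A) (false ∷ B) A⊆B B≤A = cong (false ∷_) (⊆ˢ-size⇒≡ A B A⊆B B≤A)
⊆ˢ-size⇒≡ (false ∷ A) (true ∷ B) A⊆B B≤A = ⊥-elim (<⇒≱ (s≤s (size-mono A B A⊆B)) B≤A)

dist≡1⇒⊆ˢ : ∀ {n} (A B : PSet n) → dist A B ≡ 1 → size B ≡ suc (size A) → A ⊆ˢ B
dist≡1⇒⊆ˢ (true ∷ A) (true ∷ B) d≡1 |B|≡ = dist≡1⇒⊆ˢ A B d≡1 (suc-injective |B|≡)
dist≡1⇒⊆ˢ (false ∷ A) (false ∷ B) d≡1 |B|≡ = dist≡1⇒⊆ˢ A B d≡1 |B|≡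
dist≡1⇒⊆ˢ (false ∷ A) (true ∷ B) d≡1 _ with refl ← dist≡0⇒≡ A B (suc-injective d≡1) = ⊆ˢ-refl A
dist≡1⇒⊆ˢ (true ∷ A) (false ∷ B) d≡1 |B|≡ with refl ← dist≡0⇒≡ A B (suc-injective d≡1) =
  ⊥-elim (m+1+n≢n 1 (sym |B|≡))

⊆ˢ⇒dist≡1 : ∀ {n} (A B : PSet n) → A ⊆ˢ B → size B ≡ suc (size A) → dist A B ≡ 1
⊆ˢ⇒dist≡1 (true ∷ A) (true ∷ B) A⊆B |B|≡ = ⊆ˢ⇒dist≡1 A B A⊆B (suc-injective |B|≡)
⊆ˢ⇒dist≡1 (false ∷ A) (false ∷ B) A⊆B |B|≡ = ⊆ˢ⇒dist≡1 A B A⊆B |B|≡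
⊆ˢ⇒dist≡1 (false ∷ A) (true ∷ B) A⊆B |B|≡
  with refl ← ⊆ˢ-size⇒≡ A B A⊆B (≤-reflexive (suc-injective |B|≡)) = cong suc (dist-self A)

∩-⊆ˢˡ : ∀ {n} (B S : PSet n) → B ∩ˢ S ⊆ˢ B
∩-⊆ˢˡ [] [] = _
∩-⊆ˢˡ (true ∷ B) (true ∷ S) = ∩-⊆ˢˡ B S
∩-⊆ˢˡ (true ∷ B) (false ∷ S) = ∩-⊆ˢˡ B S
∩-⊆ˢˡ (false ∷ B) (true ∷ S) = ∩-⊆ˢˡ B S
∩-⊆ˢˡ (false ∷ B) (false ∷ S) = ∩-⊆ˢˡ B S

⊆ˢ⇒∩≡ : ∀ {n} (A S : PSet n) → A ⊆ˢ S → A ∩ˢ S ≡ A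
⊆ˢ⇒∩≡ [] [] _ = refl
⊆ˢ⇒∩≡ (true ∷ A) (true ∷ S) A⊆S = cong (true ∷_) (⊆ˢ⇒∩≡ A S A⊆S)
⊆ˢ⇒∩≡ (false ∷ A) (true ∷ S) A⊆S = cong (false ∷_) (⊆ˢ⇒∩≡ A S A⊆S)
⊆ˢ⇒∩≡ (false ∷ A) (false ∷ S) A⊆S = cong (false ∷_) (⊆ˢ⇒∩≡ A S A⊆S)

∩≡⇒⊆ˢ : ∀ {n} (B S : PSet n) {A : PSet n} → B ∩ˢ S ≡ A → A ⊆ˢ B
∩≡⇒⊆ˢ B S B∩S≡A = subst (_⊆ˢ B) B∩S≡A (∩-⊆ˢˡ B S)

∅ˢ : ∀ n → PSet n
∅ˢ zero = []
∅ˢ (suc n) = false ∷ ∅ˢ n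

size-∅ˢ : ∀ n → size (∅ˢ n) ≡ 0
size-∅ˢ zero = refl
size-∅ˢ (suc n) = size-∅ˢ n

∩-∅ˢ : ∀ {n} (B : PSet n) → B ∩ˢ ∅ˢ n ≡ ∅ˢ n
∩-∅ˢ [] = refl
∩-∅ˢ (true ∷ B) = cong (false ∷_) (∩-∅ˢ B)
∩-∅ˢ (false ∷ B) = cong (false ∷_) (∩-∅ˢ B)

dist-∅ˢ : ∀ {n} (A : PSet n) → dist (∅ˢ n) A ≡ size A
dist-∅ˢ [] = refl
dist-∅ˢ (true ∷ A) = cong suc (dist-∅ˢ A)
dist-∅ˢ (false ∷ A) = dist-∅ˢ A

size-++ : ∀ {p q} (x : PSet p) (y : PSet q) → size (x Vec.++ y) ≡ size x + size y
size-++ [] y = refl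
size-++ (true ∷ x) y = cong suc (size-++ x y)
size-++ (false ∷ x) y = size-++ x y

dist-++ : ∀ {p q} (x x′ : PSet p) (y y′ : PSet q) → dist (x Vec.++ y) (x′ Vec.++ y′) ≡ dist x x′ + dist y y′
dist-++ [] [] y y′ = refl
dist-++ (true ∷ x) (true ∷ x′) y y′ = dist-++ x x′ y y′
dist-++ (false ∷ x) (false ∷ x′) y y′ = dist-++ x x′ y y′
dist-++ (true ∷ x) (false ∷ x′) y y′ = cong suc (dist-++ x x′ y y′)
dist-++ (false ∷ x) (true ∷ x′) y y′ = cong suc (dist-++ x x′ y y′)

dist≡1⇒size≢ : ∀ {n} (X Y : PSet n) → dist X Y ≡ 1 → size X ≢ size Y
dist≡1⇒size≢ [] [] ()
dist≡1⇒size≢ (true ∷ X) (true ∷ Y) d≡1 = dist≡1⇒size≢ X Y d≡1 ∘ suc-injective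
dist≡1⇒size≢ (false ∷ X) (false ∷ Y) d≡1 = dist≡1⇒size≢ X Y d≡1
dist≡1⇒size≢ (true ∷ X) (false ∷ Y) d≡1 with refl ← dist≡0⇒≡ X Y (suc-injective d≡1) = 1+n≢n
dist≡1⇒size≢ (false ∷ X) (true ∷ Y) d≡1 with refl ← dist≡0⇒≡ X Y (suc-injective d≡1) = 1+n≢n ∘ sym

2≤dist-of-size≡ : ∀ {n} (X Y : PSet n) → X ≢ Y → size X ≡ size Y → 2 ≤ dist X Y
2≤dist-of-size≡ X Y X≢Y |X|≡|Y| with dist X Y in d
... | zero = ⊥-elim (X≢Y (dist≡0⇒≡ X Y d))
... | suc zero = ⊥-elim (dist≡1⇒size≢ X Y d |X|≡|Y|)
... | suc (suc _) = s≤s (s≤s z≤n)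

setOfSize : ∀ {n k} → k ≤ n → PSet n
setOfSize {zero} z≤n = []
setOfSize {suc n} z≤n = false ∷ setOfSize {n} z≤n
setOfSize (s≤s k≤n) = true ∷ setOfSize k≤n

size-setOfSize : ∀ {n k} (k≤n : k ≤ n) → size (setOfSize k≤n) ≡ k
size-setOfSize {zero} z≤n = refl
size-setOfSize {suc n} z≤n = size-setOfSize {n} z≤n
size-setOfSize (s≤s k≤n) = cong suc (size-setOfSize k≤n)

∃-⊆ˢ-pred-size : ∀ {n j} (A : PSet n) → size A ≡ suc j → ∃[ D ] (D ⊆ˢ A × size D ≡ j)
∃-⊆ˢ-pred-size (true ∷ A) |A|≡ = false ∷ A , ⊆ˢ-refl A , suc-injective |A|≡
∃-⊆ˢ-pred-size (false ∷ A) |A|≡ with ∃-⊆ˢ-pred-size A |A|≡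
... | D , D⊆A , |D|≡ = false ∷ D , D⊆A , |D|≡

∃-⊆ˢ-same-size-≢ : ∀ {n j} (A B : PSet n) → A ⊆ˢ B → size B ≡ suc (size A) → size A ≡ suc j →
                   ∃[ C ] (C ⊆ˢ B × size C ≡ size A × C ≢ A)
∃-⊆ˢ-same-size-≢ (true ∷ A) (true ∷ B) _ |B|≡ _ = false ∷ B , ⊆ˢ-refl B , suc-injective |B|≡ , λ ()
∃-⊆ˢ-same-size-≢ (false ∷ A) (true ∷ B) A⊆B |B|≡ |A|≡
  with refl ← ⊆ˢ-size⇒≡ A B A⊆B (≤-reflexive (suc-injective |B|≡))
  with D , D⊆A , |D|≡ ← ∃-⊆ˢ-pred-size A |A|≡
  = true ∷ D , D⊆A , trans (cong suc |D|≡) (sym |A|≡) , λ ()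
∃-⊆ˢ-same-size-≢ (false ∷ A) (false ∷ B) A⊆B |B|≡ |A|≡
  with C , C⊆B , |C|≡ , C≢A ← ∃-⊆ˢ-same-size-≢ A B A⊆B |B|≡ |A|≡
  = false ∷ C , C⊆B , |C|≡ , C≢A ∘ ∷-injectiveʳ

-- Shattering

module _ {n : ℕ} {F : Family n} where

  shatters⁻ : ∀ {S} → T (shatters F S) → ∀ A → A ⊆ˢ S → ∃[ B ] (B ∈ F × B ∩ˢ S ≡ A)
  shatters⁻ {S} sh A A⊆S with find (any⁻ _ F (All.lookup (all⁺ _ _ sh) A∈))
    where A∈ = ∈-filter⁺ (T? ∘ λ X → subsetᵇ X S) (allSets-complete A) A⊆S
  ... | B , B∈F , B∩S≡A = B , B∈F , eqSet⇒≡ B∩S≡A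

  shatters⁺ : ∀ {S} → (∀ A → A ⊆ˢ S → ∃[ B ] (B ∈ F × B ∩ˢ S ≡ A)) → T (shatters F S)
  shatters⁺ {S} traces = all⁻ _ (All.tabulate λ {A} A∈ →
    let B , B∈F , B∩S≡A = traces A (proj₂ (∈-filter⁻ (T? ∘ λ X → subsetᵇ X S) {xs = allSets n} A∈))
    in any⁺ _ (lose B∈F (subst (T ∘ eqSet (B ∩ˢ S)) B∩S≡A (eqSet-refl (B ∩ˢ S)))))

  shatters-⊆ˢ-closed : ∀ {S} → (∀ A → A ⊆ˢ S → A ∈ F) → T (shatters F S)
  shatters-⊆ˢ-closed {S} closed = shatters⁺ λ A A⊆S → A , closed A A⊆S , ⊆ˢ⇒∩≡ A S A⊆S

  shatters-∅ˢ : ∀ {B} → B ∈ F → T (shatters F (∅ˢ n))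
  shatters-∅ˢ {B} B∈F = shatters⁺ λ A A⊆∅ → B , B∈F , (begin
    B ∩ˢ ∅ˢ n  ≡⟨ ∩-∅ˢ B ⟩
    ∅ˢ n       ≡⟨ ⊆ˢ-size⇒≡ A (∅ˢ n) A⊆∅ (≤-trans (≤-reflexive (size-∅ˢ n)) z≤n) ⟨
    A          ∎)
    where open ≡-Reasoning

  VC≡ : ∀ {k C} → (∀ S → T (shatters F S) → size S ≤ k) → T (shatters F C) → size C ≡ k → VC F ≡ k
  VC≡ {k} {C} bounded shC |C|≡k = foldr-⊔-≡ _
    (λ s∈ → let S , S∈ , s≡ = ∈-map⁻ size s∈ in
      subst (_≤ k) (sym s≡) (bounded S (proj₂ (∈-filter⁻ (T? ∘ shatters F) {xs = allSets n} S∈))))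
    (subst (_∈ _) |C|≡k (∈-map⁺ size (∈-filter⁺ (T? ∘ shatters F) (allSets-complete C) shC)))

-- Edges between consecutive layers, and induced matchings

Edge : ℕ → Set
Edge n = PSet n × PSet n

_≟ᵉ_ : ∀ {n} → DecidableEquality (Edge n)
_≟ᵉ_ = ×-≡-dec _≟ˢ_ _≟ˢ_

LayerEdge : ∀ {n} → ℕ → Edge n → Set
LayerEdge k (A , B) = size A ≡ k × size B ≡ suc k × dist A B ≡ 1

module _ {n k : ℕ} where

  private
    lowerLayer : List (PSet n)
    lowerLayer = filterᵇ (λ A → size A ≡ᵇ k) (allSets n)

    upperNeighbours : PSet n → List (PSet n)
    upperNeighbours A = filterᵇ (λ B → (size B ≡ᵇ suc k) ∧ adjacent A B) (allSets n)

  ∈-layerEdges⁻ : ∀ {e} → e ∈ layerEdges n k → LayerEdge k e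
  ∈-layerEdges⁻ {A , B} e∈
    with A∈ , B∈ ← ∈-concatMap-,⁻ upperNeighbours lowerLayer e∈
    with _ , |A|≡ᵇ ← ∈-filter⁻ (T? ∘ λ A → size A ≡ᵇ k) {xs = allSets n} A∈
    with _ , |B|≡ᵇ∧adj ← ∈-filter⁻ (T? ∘ λ B → (size B ≡ᵇ suc k) ∧ adjacent A B) {xs = allSets n} B∈
    with |B|≡ᵇ , adj ← to T-∧ |B|≡ᵇ∧adj
    = ≡ᵇ⇒≡ _ _ |A|≡ᵇ , ≡ᵇ⇒≡ _ _ |B|≡ᵇ , ≡ᵇ⇒≡ _ _ adj

  ∈-layerEdges⁺ : ∀ {e} → LayerEdge k e → e ∈ layerEdges n k
  ∈-layerEdges⁺ {A , B} (|A|≡ , |B|≡ , d≡1) = ∈-concatMap-,⁺ upperNeighbours lowerLayer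
    (∈-filter⁺ (T? ∘ λ A → size A ≡ᵇ k) (allSets-complete A) (≡⇒≡ᵇ _ _ |A|≡))
    (∈-filter⁺ (T? ∘ λ B → (size B ≡ᵇ suc k) ∧ adjacent A B) (allSets-complete B)
      (from T-∧ (≡⇒≡ᵇ _ _ |B|≡ , ≡⇒≡ᵇ _ _ d≡1)))

  layerEdges-unique : Unique (layerEdges n k)
  layerEdges-unique = Unique-concatMap-, upperNeighbours (filter⁺ _ (allSets-unique n))
    (λ _ → filter⁺ _ (allSets-unique n))

record Apart {n} (e f : Edge n) : Set where
  field
    lower-lower : 2 ≤ dist (proj₁ e) (proj₁ f)
    lower-upper : 2 ≤ dist (proj₁ e) (proj₂ f)
    upper-lower : 2 ≤ dist (proj₂ e) (proj₁ f)
    upper-upper : 2 ≤ dist (proj₂ e) (proj₂ f)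

Apart-sym : ∀ {n} {e f : Edge n} → Apart e f → Apart f e
Apart-sym {e = A , B} {A′ , B′} ef = record
  { lower-lower = subst (2 ≤_) (dist-comm A A′) lower-lower
  ; lower-upper = subst (2 ≤_) (dist-comm B A′) upper-lower
  ; upper-lower = subst (2 ≤_) (dist-comm A B′) lower-upper
  ; upper-upper = subst (2 ≤_) (dist-comm B B′) upper-upper
  }
  where open Apart ef

Apart-irrefl : ∀ {n} {e : Edge n} → ¬ Apart e e
Apart-irrefl {e = A , _} ee = 2≤dist⇒≢ A A (Apart.lower-lower ee) refl

module _ {n} (X Y : PSet n) where

  2≤dist⁺ : ¬ T (eqSet X Y) → ¬ T (adjacent X Y) → 2 ≤ dist X Y
  2≤dist⁺ X≠Y ¬adj with dist X Y in d
  ... | zero = ⊥-elim (X≠Y (subst (T ∘ eqSet X) (dist≡0⇒≡ X Y d) (eqSet-refl X)))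
  ... | suc zero = ⊥-elim (¬adj _)   -- here ¬adj : ¬ T (1 ≡ᵇ 1)
  ... | suc (suc _) = s≤s (s≤s z≤n)

  2≤dist⁻ : 2 ≤ dist X Y → ¬ T (eqSet X Y) × ¬ T (adjacent X Y)
  2≤dist⁻ 2≤d = (2≤dist⇒≢ X Y 2≤d ∘ eqSet⇒≡)
              , (λ adj → <⇒≱ 2≤d (≤-reflexive (≡ᵇ⇒≡ _ _ adj)))

not-∨⁻ : ∀ x {y} → T (not (x ∨ y)) → ¬ T x × T (not y)
not-∨⁻ false t = (λ ()) , t

not-∨⁺ : ∀ {x y} → ¬ T x → T (not y) → T (not (x ∨ y))
not-∨⁺ {false} _ t = t
not-∨⁺ {true} ¬t _ = ¬t _

T-not⁻ : ∀ {x} → T (not x) → ¬ T x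
T-not⁻ {false} _ ()

T-not⁺ : ∀ {x} → ¬ T x → T (not x)
T-not⁺ {false} _ = _
T-not⁺ {true} ¬t = ¬t _

compatible⇒Apart : ∀ {n} {e f : Edge n} → T (compatible e f) → Apart e f
compatible⇒Apart {e = A , B} {A′ , B′} c₀ =
  let ¬AA′ , c₁ = not-∨⁻ (eqSet A A′) c₀
      ¬AB′ , c₂ = not-∨⁻ (eqSet A B′) c₁
      ¬BA′ , c₃ = not-∨⁻ (eqSet B A′) c₂
      ¬BB′ , c₄ = not-∨⁻ (eqSet B B′) c₃
      ¬A~A′ , c₅ = not-∨⁻ (adjacent A A′) c₄
      ¬A~B′ , c₆ = not-∨⁻ (adjacent A B′) c₅
      ¬B~A′ , c₇ = not-∨⁻ (adjacent B A′) c₆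
  in record
    { lower-lower = 2≤dist⁺ A A′ ¬AA′ ¬A~A′
    ; lower-upper = 2≤dist⁺ A B′ ¬AB′ ¬A~B′
    ; upper-lower = 2≤dist⁺ B A′ ¬BA′ ¬B~A′
    ; upper-upper = 2≤dist⁺ B B′ ¬BB′ (T-not⁻ c₇)
    }

Apart⇒compatible : ∀ {n} {e f : Edge n} → Apart e f → T (compatible e f)
Apart⇒compatible {e = A , B} {A′ , B′} ef =
  not-∨⁺ (proj₁ AA′) (not-∨⁺ (proj₁ AB′) (not-∨⁺ (proj₁ BA′) (not-∨⁺ (proj₁ BB′)
    (not-∨⁺ (proj₂ AA′) (not-∨⁺ (proj₂ AB′) (not-∨⁺ (proj₂ BA′) (T-not⁺ (proj₂ BB′))))))))
  where
  AA′ : ¬ T (eqSet A A′) × ¬ T (adjacent A A′)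
  AA′ = 2≤dist⁻ A A′ (Apart.lower-lower ef)
  AB′ : ¬ T (eqSet A B′) × ¬ T (adjacent A B′)
  AB′ = 2≤dist⁻ A B′ (Apart.lower-upper ef)
  BA′ : ¬ T (eqSet B A′) × ¬ T (adjacent B A′)
  BA′ = 2≤dist⁻ B A′ (Apart.upper-lower ef)
  BB′ : ¬ T (eqSet B B′) × ¬ T (adjacent B B′)
  BB′ = 2≤dist⁻ B B′ (Apart.upper-upper ef)

compatible-sym : ∀ {n} {e f : Edge n} → T (compatible e f) → T (compatible f e)
compatible-sym {e = e} {f} = Apart⇒compatible ∘ Apart-sym ∘ compatible⇒Apart {e = e} {f}

record InducedMatching {n} (k : ℕ) (M : List (Edge n)) : Set where
  field
    unique : Unique M
    layer : ∀ {e} → e ∈ M → LayerEdge k e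
    apart : ∀ {e f} → e ∈ M → f ∈ M → e ≢ f → Apart e f

inducedMatching : ∀ {n k} {M : List (Edge n)} → M ∈ sublists (layerEdges n k) →
                  T (pairwiseᵇ compatible M) → InducedMatching k M
inducedMatching M∈ pw = record
  { unique = pairwiseᵇ⇒Unique (λ e → Apart-irrefl ∘ compatible⇒Apart {e = e}) pw
  ; layer = ∈-layerEdges⁻ ∘ sublists-⊆ _ M∈
  ; apart = λ e∈ f∈ e≢f → compatible⇒Apart (pairwiseᵇ⁻ (λ {e} {f} → compatible-sym {e = e} {f}) pw e∈ f∈ e≢f)
  }

-- The maximal family of an induced matching

module _ {n k : ℕ} where

  open import Data.List.Membership.DecPropositional (_≟ˢ_ {n}) using (_∈?_)

  lowers uppers : List (Edge n) → List (PSet n)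
  lowers = map proj₁
  uppers = map proj₂

  InFamily : List (Edge n) → PSet n → Set
  InFamily M S = S ∈ uppers M ⊎ (size S ≤ k × S ∉ lowers M)

  InFamily? : (M : List (Edge n)) → Decidable (InFamily M)
  InFamily? M S = S ∈? uppers M ⊎-dec (size S ≤? k ×-dec ¬? (S ∈? lowers M))

  family : List (Edge n) → Family n
  family M = filterᵇ (does ∘ InFamily? M) (allSets n)

  ∈-family⁺ : ∀ {M S} → InFamily M S → S ∈ family M
  ∈-family⁺ {M} {S} inF = ∈-filter⁺ (T? ∘ does ∘ InFamily? M) (allSets-complete S) (does⁺ (InFamily? M S) inF)

  ∈-family⁻ : ∀ {M S} → S ∈ family M → InFamily M S
  ∈-family⁻ {M} {S} S∈ = does⁻ (InFamily? M S) (proj₂ (∈-filter⁻ (T? ∘ does ∘ InFamily? M) {xs = allSets n} S∈))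

  module _ {M : List (Edge n)} (IM : InducedMatching k M) where

    open InducedMatching IM

    edge-of-lower : ∀ {A} → A ∈ lowers M → ∃[ B ] ((A , B) ∈ M)
    edge-of-lower A∈ with ∈-map⁻ proj₁ A∈
    ... | (_ , B) , e∈ , refl = B , e∈

    edge-of-upper : ∀ {B} → B ∈ uppers M → ∃[ A ] ((A , B) ∈ M)
    edge-of-upper B∈ with ∈-map⁻ proj₂ B∈
    ... | (A , _) , e∈ , refl = A , e∈

    size-lower : ∀ {A} → A ∈ lowers M → size A ≡ k
    size-lower A∈ = proj₁ (layer (proj₂ (edge-of-lower A∈)))

    size-upper : ∀ {B} → B ∈ uppers M → size B ≡ suc k
    size-upper B∈ = proj₁ (proj₂ (layer (proj₂ (edge-of-upper B∈))))

    lowers-unique : Unique (lowers M)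
    lowers-unique = Unique-map proj₁ unique λ {e} {f} e∈ f∈ A≡A′ → decidable-stable (e ≟ᵉ f) λ e≢f →
      2≤dist⇒≢ _ _ (Apart.lower-lower (apart e∈ f∈ e≢f)) A≡A′

    uppers-unique : Unique (uppers M)
    uppers-unique = Unique-map proj₂ unique λ {e} {f} e∈ f∈ B≡B′ → decidable-stable (e ≟ᵉ f) λ e≢f →
      2≤dist⇒≢ _ _ (Apart.upper-upper (apart e∈ f∈ e≢f)) B≡B′

    count-lowers : count (λ S → does (S ∈? lowers M)) (allSets n) ≡ length M
    count-lowers = trans (count-∈ _≟ˢ_ (allSets-unique n) lowers-unique (λ {A} _ → allSets-complete A))
                         (length-map proj₁ M)

    count-uppers : count (λ S → does (S ∈? uppers M)) (allSets n) ≡ length M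
    count-uppers = trans (count-∈ _≟ˢ_ (allSets-unique n) uppers-unique (λ {A} _ → allSets-complete A))
                         (length-map proj₂ M)

    length-family : length (family M) ≡ binom≤ n k
    length-family = +-cancelʳ-≡ _ _ _ (begin
      length (family M) + count (λ S → does (S ∈? lowers M)) (allSets n)
        ≡⟨ count-pointwise _ _ _ _ exchange (allSets n) ⟩
      count (λ S → does (size S ≤? k)) (allSets n) + count (λ S → does (S ∈? uppers M)) (allSets n)
        ≡⟨ cong₂ _+_ (count-size≤ n k) (trans count-uppers (sym count-lowers)) ⟩
      binom≤ n k + count (λ S → does (S ∈? lowers M)) (allSets n) ∎)
      where
      open ≡-Reasoning
      exchange : ∀ S → ind (does (InFamily? M S)) + ind (does (S ∈? lowers M))
                     ≡ ind (does (size S ≤? k)) + ind (does (S ∈? uppers M))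
      exchange S with S ∈? uppers M
      ... | yes S∈up
        rewrite dec-false (S ∈? lowers M) (λ S∈low → 1+n≢n (trans (sym (size-upper S∈up)) (size-lower S∈low)))
              | dec-false (size S ≤? k) (<⇒≱ (≤-reflexive (sym (size-upper S∈up)))) = refl
      ... | no _ with S ∈? lowers M
      ...   | yes S∈low rewrite dec-true (size S ≤? k) (≤-reflexive (size-lower S∈low)) = refl
      ...   | no _ with size S ≤ᵇ k
      ...     | true = refl
      ...     | false = refl

    size-upper≡1+size-lower : ∀ {A B} → (A , B) ∈ M → size B ≡ suc (size A)
    size-upper≡1+size-lower e∈ = let |A|≡ , |B|≡ , _ = layer e∈ in trans |B|≡ (cong suc (sym |A|≡))

    lower⊆ˢupper : ∀ {A B} → (A , B) ∈ M → A ⊆ˢ B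
    lower⊆ˢupper {A} {B} e∈ = dist≡1⇒⊆ˢ A B (proj₂ (proj₂ (layer e∈))) (size-upper≡1+size-lower e∈)

    lower∉family : ∀ {A B} → (A , B) ∈ M → A ∉ family M
    lower∉family {A} e∈ A∈F with ∈-family⁻ A∈F
    ... | inj₁ A∈up = 1+n≢n (trans (sym (size-upper A∈up)) (proj₁ (layer e∈)))
    ... | inj₂ (_ , A∉low) = A∉low (∈-map⁺ proj₁ e∈)

    lower-not-trace : ∀ {A S B} → (A , S) ∈ M → B ∈ family M → B ∩ˢ S ≢ A
    lower-not-trace {A} {S} {B} e∈ B∈F B∩S≡A with ∈-family⁻ B∈F
    ... | inj₂ (|B|≤k , B∉low) =
      B∉low (subst (_∈ lowers M) (⊆ˢ-size⇒≡ A B A⊆B (subst (size B ≤_) (sym |A|≡k) |B|≤k)) (∈-map⁺ proj₁ e∈))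
      where
      A⊆B : A ⊆ˢ B
      A⊆B = ∩≡⇒⊆ˢ B S B∩S≡A
      |A|≡k : size A ≡ k
      |A|≡k = proj₁ (layer e∈)
    ... | inj₁ B∈up with A′ , f∈ ← edge-of-upper B∈up =
      <⇒≱ (Apart.lower-upper (apart e∈ f∈ e≢f)) (≤-reflexive A~B)
      where
      A⊆B : A ⊆ˢ B
      A⊆B = ∩≡⇒⊆ˢ B S B∩S≡A
      A~B : dist A B ≡ 1
      A~B = ⊆ˢ⇒dist≡1 A B A⊆B (trans (size-upper B∈up) (cong suc (sym (proj₁ (layer e∈)))))
      e≢f : (A , S) ≢ (A′ , B)
      e≢f refl = 1+n≢n (begin
        suc k            ≡⟨ proj₁ (proj₂ (layer e∈)) ⟨
        size S           ≡⟨ cong size (⊆ˢ⇒∩≡ S S (⊆ˢ-refl S)) ⟨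
        size (S ∩ˢ S)    ≡⟨ cong size B∩S≡A ⟩
        size A           ≡⟨ proj₁ (layer e∈) ⟩
        k                ∎)
        where open ≡-Reasoning

    large-not-shattered : ∀ {S} → k < size S → ¬ T (shatters (family M) S)
    large-not-shattered {S} k<|S| sh with B , B∈F , B∩S≡S ← shatters⁻ sh S (⊆ˢ-refl S) with ∈-family⁻ B∈F
    ... | inj₂ (|B|≤k , _) = <⇒≱ k<|S| (≤-trans (size-mono S B (∩≡⇒⊆ˢ B S B∩S≡S)) |B|≤k)
    ... | inj₁ B∈up
      with refl ← ⊆ˢ-size⇒≡ S B (∩≡⇒⊆ˢ B S B∩S≡S) (≤-trans (≤-reflexive (size-upper B∈up)) k<|S|)
      with A , e∈ ← edge-of-upper B∈up
      with B′ , B′∈F , B′∩S≡A ← shatters⁻ sh A (lower⊆ˢupper e∈)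
      = lower-not-trace e∈ B′∈F B′∩S≡A

    shattered⇒size≤ : ∀ S → T (shatters (family M) S) → size S ≤ k
    shattered⇒size≤ S sh = decidable-stable (size S ≤? k) (λ |S|≰k → large-not-shattered (≰⇒> |S|≰k) sh)

    shatters-∉lowers : ∀ {K} → size K ≡ k → K ∉ lowers M → T (shatters (family M) K)
    shatters-∉lowers {K} |K|≡k K∉low = shatters-⊆ˢ-closed λ X X⊆K →
      ∈-family⁺ (inj₂ (subst (size X ≤_) |K|≡k (size-mono X K X⊆K) , λ X∈low →
        K∉low (subst (_∈ lowers M) (⊆ˢ-size⇒≡ X K X⊆K (≤-reflexive (trans |K|≡k (sym (size-lower X∈low)))))
                     X∈low)))

    sibling∉lowers : ∀ {A B K} → (A , B) ∈ M → K ⊆ˢ B → size K ≡ k → K ≢ A → K ∉ lowers M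
    sibling∉lowers {A} {B} {K} e∈ K⊆B |K|≡k K≢A K∈low with D , f∈ ← edge-of-lower K∈low =
      <⇒≱ (Apart.upper-lower (apart e∈ f∈ (K≢A ∘ sym ∘ cong proj₁))) (≤-reflexive B~K)
      where
      B~K : dist B K ≡ 1
      B~K = trans (dist-comm B K) (⊆ˢ⇒dist≡1 K B K⊆B (trans (proj₁ (proj₂ (layer e∈))) (cong suc (sym |K|≡k))))

  ∃-shattered-of-size : ∀ {M} → InducedMatching k M → k ≤ n → ∃[ K ] (T (shatters (family M) K) × size K ≡ k)
  ∃-shattered-of-size {[]} IM k≤n =
    setOfSize k≤n , shatters-∉lowers IM (size-setOfSize k≤n) (λ ()) , size-setOfSize k≤n
  ∃-shattered-of-size {(A , B) ∷ M} IM _ with size A in |A|≡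
  ... | zero = ∅ˢ n , shatters-∅ˢ (∈-family⁺ {(A , B) ∷ M} (inj₁ (here refl)))
             , trans (size-∅ˢ n) (trans (sym |A|≡) |A|≡k)
    where
    |A|≡k : size A ≡ k
    |A|≡k = proj₁ (InducedMatching.layer IM (here refl))
  ... | suc _
    with K , K⊆B , |K|≡|A| , K≢A ←
           ∃-⊆ˢ-same-size-≢ A B (lower⊆ˢupper IM (here refl)) (size-upper≡1+size-lower IM (here refl)) |A|≡
    = K , shatters-∉lowers IM |K|≡k (sibling∉lowers IM (here refl) K⊆B |K|≡k K≢A) , |K|≡k
    where
    |A|≡k : size A ≡ k
    |A|≡k = proj₁ (InducedMatching.layer IM (here refl))
    |K|≡k : size K ≡ k
    |K|≡k = trans |K|≡|A| |A|≡k

  VC-family : ∀ {M} → InducedMatching k M → k ≤ n → VC (family M) ≡ k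
  VC-family {M} IM k≤n =
    let K , shK , |K|≡k = ∃-shattered-of-size IM k≤n in VC≡ {F = family M} (shattered⇒size≤ IM) shK |K|≡k

  family-⊆ : ∀ {M M′} → InducedMatching k M → InducedMatching k M′ → family M ≡ family M′ → M ⊆ M′
  family-⊆ {M} {M′} IM IM′ F≡F′ {A , B} e∈
    with ∈-family⁻ (subst (B ∈_) F≡F′ (∈-family⁺ (inj₁ (∈-map⁺ proj₂ e∈))))
  ... | inj₂ (|B|≤k , _) = ⊥-elim (<⇒≱ (≤-reflexive (sym (proj₁ (proj₂ (InducedMatching.layer IM e∈))))) |B|≤k)
  ... | inj₁ B∈up′ with A′ , f∈ ← edge-of-upper IM′ B∈up′ with A′ ≟ˢ A
  ...   | yes refl = f∈
  ...   | no A′≢A =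
    ⊥-elim (<⇒≱ (Apart.upper-lower (InducedMatching.apart IM′ f∈ (proj₂ (edge-of-lower IM′ A∈low′)) (A′≢A ∘ cong proj₁)))
                (≤-reflexive B~A))
    where
    |A|≡k : size A ≡ k
    |A|≡k = proj₁ (InducedMatching.layer IM e∈)
    A∈low′ : A ∈ lowers M′
    A∈low′ = decidable-stable (A ∈? lowers M′) λ A∉low′ →
      lower∉family IM e∈ (subst (A ∈_) (sym F≡F′) (∈-family⁺ (inj₂ (≤-reflexive |A|≡k , A∉low′))))
    B~A : dist B A ≡ 1
    B~A = trans (dist-comm B A) (proj₂ (proj₂ (InducedMatching.layer IM e∈)))

  inducedMatching-∈ : ∀ {M} → M ∈ filterᵇ (pairwiseᵇ compatible) (sublists (layerEdges n k)) →
                      M ∈ sublists (layerEdges n k) × InducedMatching k M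
  inducedMatching-∈ M∈ =
    let M∈sub , pw = ∈-filter⁻ (T? ∘ pairwiseᵇ compatible) M∈ in M∈sub , inducedMatching M∈sub pw

  family-maximal : ∀ {M} → InducedMatching k M → k ≤ n →
                   T ((VC (family M) ≡ᵇ k) ∧ (length (family M) ≡ᵇ binom≤ n k))
  family-maximal IM k≤n = from T-∧ (≡⇒≡ᵇ _ _ (VC-family IM k≤n) , ≡⇒≡ᵇ _ _ (length-family IM))

  IndMat≤m : k ≤ n → IndMat n k ≤ m n k
  IndMat≤m k≤n = length≤count family _ (filter⁺ _ (sublists-unique layerEdges-unique))
    (λ M∈ → filter∈sublists _ (allSets n) , family-maximal (proj₂ (inducedMatching-∈ M∈)) k≤n)
    (λ M∈ M′∈ F≡F′ → let M∈sub , IM = inducedMatching-∈ M∈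
                         M′∈sub , IM′ = inducedMatching-∈ M′∈
                     in sublists-ext layerEdges-unique M∈sub M′∈sub
                                     (family-⊆ IM IM′ F≡F′) (family-⊆ IM′ IM (sym F≡F′)))

-- Induced matchings from choices of unit vectors

units : (t : ℕ) → List (PSet t)
units zero = []
units (suc t) = (true ∷ ∅ˢ t) ∷ map (false ∷_) (units t)

length-units : ∀ t → length (units t) ≡ t
length-units zero = refl
length-units (suc t) = cong suc (trans (length-map (false ∷_) (units t)) (length-units t))

size-units : ∀ t {u} → u ∈ units t → size u ≡ 1
size-units (suc t) (here refl) = cong suc (size-∅ˢ t)
size-units (suc t) (there u∈) with ∈-map⁻ (false ∷_) u∈
... | _ , v∈ , refl = size-units t v∈

units-unique : ∀ t → Unique (units t)
units-unique zero = []
units-unique (suc t) =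
  All.map⁺ (All.tabulate λ _ ()) ∷ Unique-map (false ∷_) (units-unique t) (λ _ _ → ∷-injectiveʳ)

module _ (m t k : ℕ) where

  edge : PSet m → PSet t → Edge (m + t)
  edge a u = a Vec.++ ∅ˢ t , a Vec.++ u

  edge-injective : ∀ {a a′ u u′} → edge a u ≡ edge a′ u′ → a ≡ a′ × u ≡ u′
  edge-injective {a} {a′} = ++-injective a a′ ∘ cong proj₂

  choices : List (PSet m) → List (List (Edge (m + t)))
  choices [] = [] ∷ []
  choices (a ∷ as) = cartesianProductWith (λ u S → edge a u ∷ S) (units t) (choices as)

  length-choices : ∀ as → length (choices as) ≡ t ^ length as
  length-choices [] = refl
  length-choices (a ∷ as) = trans (length-cartesianProductWith _ (units t) (choices as))
                                  (cong₂ _*_ (length-units t) (length-choices as))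

  choices-unique : ∀ as → Unique (choices as)
  choices-unique [] = [] ∷ []
  choices-unique (a ∷ as) = cartesianProductWith⁺ _
    (λ e∷S≡e′∷S′ → let e≡e′ , S≡S′ = ∷-injective e∷S≡e′∷S′ in proj₂ (edge-injective e≡e′) , S≡S′)
    (units-unique t) (choices-unique as)

  ∈-choices-∷⁻ : ∀ a as {S} → S ∈ choices (a ∷ as) →
                 ∃[ u ] ∃[ S′ ] (u ∈ units t × S′ ∈ choices as × S ≡ edge a u ∷ S′)
  ∈-choices-∷⁻ a as S∈ = ∈-cartesianProductWith⁻ _ (units t) (choices as) S∈

  ∈-choice⁻ : ∀ as {S e} → S ∈ choices as → e ∈ S → ∃[ a ] ∃[ u ] (a ∈ as × u ∈ units t × e ≡ edge a u)
  ∈-choice⁻ [] (here refl) ()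
  ∈-choice⁻ (a ∷ as) S∈ e∈ with ∈-choices-∷⁻ a as S∈
  ... | u , S′ , u∈ , S′∈ , refl with e∈
  ...   | here refl = a , u , here refl , u∈ , refl
  ...   | there e∈S′ = let a′ , u′ , a′∈ , u′∈ , e≡ = ∈-choice⁻ as S′∈ e∈S′ in a′ , u′ , there a′∈ , u′∈ , e≡

  lower∈ : ∀ as {S a u} → S ∈ choices as → edge a u ∈ S → a ∈ as
  lower∈ as S∈ e∈ =
    let a′ , _ , a′∈ , _ , e≡ = ∈-choice⁻ as S∈ e∈ in subst (_∈ as) (sym (proj₁ (edge-injective e≡))) a′∈

  choice-functional : ∀ {as} → Unique as → ∀ {S a u u′} → S ∈ choices as → edge a u ∈ S → edge a u′ ∈ S → u ≡ u′
  choice-functional {[]} _ (here refl) ()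
  choice-functional {b ∷ as} ux@(_ ∷ uas) S∈ e∈ e′∈ with ∈-choices-∷⁻ b as S∈
  ... | v , S′ , _ , S′∈ , refl with e∈ | e′∈
  ...   | here e≡ | here e′≡ = trans (proj₂ (edge-injective e≡)) (sym (proj₂ (edge-injective e′≡)))
  ...   | there e∈S′ | there e′∈S′ = choice-functional uas S′∈ e∈S′ e′∈S′
  ...   | here e≡ | there e′∈S′ =
    ⊥-elim (Unique[x∷xs]⇒x∉xs ux (subst (_∈ as) (proj₁ (edge-injective e≡)) (lower∈ as S′∈ e′∈S′)))
  ...   | there e∈S′ | here e′≡ =
    ⊥-elim (Unique[x∷xs]⇒x∉xs ux (subst (_∈ as) (proj₁ (edge-injective e′≡)) (lower∈ as S′∈ e∈S′)))

  choices-⊆⇒≡ : ∀ {as} → Unique as → ∀ {S S′} → S ∈ choices as → S′ ∈ choices as → S ⊆ S′ → S ≡ S′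
  choices-⊆⇒≡ {[]} _ (here refl) (here refl) _ = refl
  choices-⊆⇒≡ {b ∷ as} ux@(_ ∷ uas) S∈ S′∈ S⊆S′ with ∈-choices-∷⁻ b as S∈ | ∈-choices-∷⁻ b as S′∈
  ... | v , R , _ , R∈ , refl | v′ , R′ , _ , R′∈ , refl with S⊆S′ (here refl)
  ...   | there e∈R′ = ⊥-elim (Unique[x∷xs]⇒x∉xs ux (lower∈ as R′∈ e∈R′))
  ...   | here e≡ = cong₂ _∷_ e≡ (choices-⊆⇒≡ uas R∈ R′∈ R⊆R′)
    where
    R⊆R′ : R ⊆ R′
    R⊆R′ e∈R with S⊆S′ (there e∈R)
    ... | there e∈R′ = e∈R′
    ... | here refl = ⊥-elim (Unique[x∷xs]⇒x∉xs ux (lower∈ as R∈ e∈R))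

  open import Data.List.Membership.DecPropositional (_≟ᵉ_ {m + t}) using (_∈?_)

  kSets : List (PSet m)
  kSets = filterᵇ (λ a → does (size a ≟ k)) (allSets m)

  size-kSets : ∀ {a} → a ∈ kSets → size a ≡ k
  size-kSets a∈ = ≡ᵇ⇒≡ _ _ (proj₂ (∈-filter⁻ (T? ∘ λ a → does (size a ≟ k)) {xs = allSets m} a∈))

  size-lower-edge : ∀ a u → size (proj₁ (edge a u)) ≡ size a
  size-lower-edge a u = trans (size-++ a (∅ˢ t)) (trans (cong (size a +_) (size-∅ˢ t)) (+-identityʳ _))

  size-upper-edge : ∀ a {u} → u ∈ units t → size (proj₂ (edge a u)) ≡ suc (size a)
  size-upper-edge a u∈ = trans (size-++ a _) (trans (cong (size a +_) (size-units t u∈)) (+-comm (size a) 1))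

  dist-mixed-ends : ∀ a a′ {u} → u ∈ units t → dist (proj₁ (edge a′ u)) (proj₂ (edge a u)) ≡ dist a′ a + 1
  dist-mixed-ends a a′ {u} u∈ =
    trans (dist-++ a′ a (∅ˢ t) u) (cong (dist a′ a +_) (trans (dist-∅ˢ u) (size-units t u∈)))

  edge-layer : ∀ {a u} → a ∈ kSets → u ∈ units t → LayerEdge k (edge a u)
  edge-layer {a} {u} a∈ u∈ =
      trans (size-lower-edge a u) (size-kSets a∈)
    , trans (size-upper-edge a u∈) (cong suc (size-kSets a∈))
    , trans (dist-mixed-ends a a u∈) (cong (_+ 1) (dist-self a))

  edges-apart : ∀ {a a′ u u′} → a ∈ kSets → a′ ∈ kSets → u ∈ units t → u′ ∈ units t → a ≢ a′ →
                Apart (edge a u) (edge a′ u′)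
  edges-apart {a} {a′} {u} {u′} a∈ a′∈ u∈ u′∈ a≢a′ = record
    { lower-lower = 2≤dist-of-size≡ _ _ (a≢a′ ∘ proj₁ ∘ ++-injective a a′)
        (trans (size-lower-edge a u) (trans (size-kSets a∈) (sym (trans (size-lower-edge a′ u′) (size-kSets a′∈)))))
    ; lower-upper = ≤-trans (+-monoˡ-≤ 1 (1≤dist a a′ a≢a′)) (≤-reflexive (sym (dist-mixed-ends a′ a u′∈)))
    ; upper-lower = ≤-trans (+-monoˡ-≤ 1 (1≤dist a′ a (a≢a′ ∘ sym)))
        (≤-reflexive (sym (trans (dist-comm (proj₂ (edge a u)) (proj₁ (edge a′ u′))) (dist-mixed-ends a a′ u∈))))
    ; upper-upper = 2≤dist-of-size≡ _ _ (a≢a′ ∘ proj₁ ∘ ++-injective a a′)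
        (trans (size-upper-edge a u∈)
          (trans (cong suc (trans (size-kSets a∈) (sym (size-kSets a′∈)))) (sym (size-upper-edge a′ u′∈))))
    }

  kSets-unique : Unique kSets
  kSets-unique = filter⁺ _ (allSets-unique m)

  choice-apart : ∀ {S e f} → S ∈ choices kSets → e ∈ S → f ∈ S → e ≢ f → Apart e f
  choice-apart S∈ e∈ f∈ e≢f
    with a , u , a∈ , u∈ , refl ← ∈-choice⁻ kSets S∈ e∈
    with a′ , u′ , a′∈ , u′∈ , refl ← ∈-choice⁻ kSets S∈ f∈
    = edges-apart a∈ a′∈ u∈ u′∈ λ where refl → e≢f (cong (edge a) (choice-functional kSets-unique S∈ e∈ f∈))

  matching : List (Edge (m + t)) → List (Edge (m + t))
  matching S = filter (_∈? S) (layerEdges (m + t) k)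

  matching-⊆ : ∀ S → matching S ⊆ S
  matching-⊆ S = proj₂ ∘ ∈-filter⁻ (_∈? S) {xs = layerEdges (m + t) k}

  ⊆-matching : ∀ {S} → S ∈ choices kSets → S ⊆ matching S
  ⊆-matching {S} S∈ e∈ with a , u , a∈ , u∈ , refl ← ∈-choice⁻ kSets S∈ e∈ =
    ∈-filter⁺ (_∈? S) (∈-layerEdges⁺ (edge-layer a∈ u∈)) e∈

  t^[mCk]≤IndMat[m+t] : t ^ (m C k) ≤ IndMat (m + t) k
  t^[mCk]≤IndMat[m+t] =
    subst (_≤ IndMat (m + t) k) (trans (length-choices kSets) (cong (t ^_) (count-size m k)))
    (length≤count matching (pairwiseᵇ compatible) {ys = sublists (layerEdges (m + t) k)} (choices-unique kSets)
      (λ {S} S∈ → filter∈sublists (_∈? S) (layerEdges (m + t) k)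
                , pairwiseᵇ⁺ (filter⁺ _ layerEdges-unique)
                    (λ e∈ f∈ → Apart⇒compatible ∘ choice-apart S∈ (matching-⊆ S e∈) (matching-⊆ S f∈)))
      (λ {S} {S′} S∈ S′∈ MS≡MS′ →
        choices-⊆⇒≡ kSets-unique S∈ S′∈ λ e∈S → matching-⊆ S′ (subst (_ ∈_) MS≡MS′ (⊆-matching S∈ e∈S))))

-- A binomial estimate

nCj≤[1+n]Cj : ∀ n j → n C j ≤ suc n C j
nCj≤[1+n]Cj n zero = ≤-refl
nCj≤[1+n]Cj n (suc j) = subst (n C suc j ≤_) (nCk+nC[k+1]≡[n+1]C[k+1] n j) (m≤n+m _ _)

C-monoˡ-≤ : ∀ {n n′} j → n ≤ n′ → n C j ≤ n′ C j
C-monoˡ-≤ {n} {n′} j n≤n′ = subst (λ x → n C j ≤ x C j) (m∸n+n≡m n≤n′) (C-mono-+ (n′ ∸ n))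
  where
  C-mono-+ : ∀ d → n C j ≤ (d + n) C j
  C-mono-+ zero = ≤-refl
  C-mono-+ (suc d) = ≤-trans (C-mono-+ d) (nCj≤[1+n]Cj (d + n) j)

[1+n]*nCj≡[1+j]*[1+n]C[1+j] : ∀ n j → suc n * (n C j) ≡ suc j * (suc n C suc j)
[1+n]*nCj≡[1+j]*[1+n]C[1+j] zero zero = refl
[1+n]*nCj≡[1+j]*[1+n]C[1+j] zero (suc i) = sym (*-zeroʳ (suc (suc i)))
[1+n]*nCj≡[1+j]*[1+n]C[1+j] (suc p) zero =
  trans (*-identityʳ (suc (suc p))) (sym (trans (*-identityˡ _) (nC1≡n (suc (suc p)))))
[1+n]*nCj≡[1+j]*[1+n]C[1+j] (suc p) (suc i) = sym (begin
  suc (suc i) * (suc (suc p) C suc (suc i))  ≡⟨ cong (suc (suc i) *_) (nCk+nC[k+1]≡[n+1]C[k+1] (suc p) (suc i)) ⟨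
  suc (suc i) * (a + b)                      ≡⟨ split i a b ⟩
  a + suc i * a + suc (suc i) * b
    ≡⟨ cong₂ (λ u v → a + u + v) ([1+n]*nCj≡[1+j]*[1+n]C[1+j] p i) ([1+n]*nCj≡[1+j]*[1+n]C[1+j] p (suc i)) ⟨
  a + suc p * x + suc p * y                  ≡⟨ merge p a x y ⟩
  a + suc p * (x + y)                        ≡⟨ cong (λ z → a + suc p * z) (nCk+nC[k+1]≡[n+1]C[k+1] p i) ⟩
  a + suc p * a                              ≡⟨⟩
  suc (suc p) * a                            ∎)
  where
  open ≡-Reasoning
  a = suc p C suc i
  b = suc p C suc (suc i)
  x = p C i
  y = p C suc i
  split : ∀ i a b → suc (suc i) * (a + b) ≡ a + suc i * a + suc (suc i) * b
  split = solve-∀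
  merge : ∀ p a x y → a + suc p * x + suc p * y ≡ a + suc p * (x + y)
  merge = solve-∀

nC[1+j]≤[n-1]C[1+j]+[n-1]Cj : ∀ n j → n C suc j ≤ pred n C suc j + pred n C j
nC[1+j]≤[n-1]C[1+j]+[n-1]Cj zero j = z≤n
nC[1+j]≤[n-1]C[1+j]+[n-1]Cj (suc n) j =
  ≤-reflexive (trans (sym (nCk+nC[k+1]≡[n+1]C[k+1] n j)) (+-comm (n C j) (n C suc j)))

nC[1+j]≤[n-t]C[1+j]+t*[n-1]Cj : ∀ n j t → n C suc j ≤ (n ∸ t) C suc j + t * (pred n C j)
nC[1+j]≤[n-t]C[1+j]+t*[n-1]Cj n j zero = m≤m+n _ _
nC[1+j]≤[n-t]C[1+j]+t*[n-1]Cj n j (suc t) = begin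
  n C suc j                                        ≤⟨ nC[1+j]≤[n-t]C[1+j]+t*[n-1]Cj n j t ⟩
  (n ∸ t) C suc j + t * c                          ≤⟨ +-monoˡ-≤ (t * c) (nC[1+j]≤[n-1]C[1+j]+[n-1]Cj (n ∸ t) j) ⟩
  pred (n ∸ t) C suc j + pred (n ∸ t) C j + t * c  ≤⟨ +-monoˡ-≤ (t * c) (+-monoʳ-≤ _ (C-monoˡ-≤ j (pred-mono-≤ (m∸n≤m n t)))) ⟩
  pred (n ∸ t) C suc j + c + t * c                 ≡⟨ +-assoc _ c (t * c) ⟩
  pred (n ∸ t) C suc j + suc t * c                 ≡⟨ cong (λ x → x C suc j + suc t * c) (pred[m∸n]≡m∸[1+n] n t) ⟩
  (n ∸ suc t) C suc j + suc t * c                  ∎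
  where
  open ≤-Reasoning
  c = pred n C j

-- By Pascal's rule and absorption n·C(n,k) ≤ n·C(n−t,k) + t·k·C(n,k); multiply by s+1.
s*nCk≤[1+s]*[n-t]Ck : ∀ n k t s → t * k * suc s ≤ n → s * (n C k) ≤ suc s * ((n ∸ t) C k)
s*nCk≤[1+s]*[n-t]Ck n zero t s _ = *-monoˡ-≤ 1 (n≤1+n s)
s*nCk≤[1+s]*[n-t]Ck zero (suc j) t s _ = ≤-trans (≤-reflexive (*-zeroʳ s)) z≤n
s*nCk≤[1+s]*[n-t]Ck (suc n) (suc j) t s hyp = *-cancelˡ-≤ (suc n) (begin
  suc n * (s * Cn)                 ≡⟨ x∙yz≈y∙xz (suc n) s Cn ⟩
  s * (suc n * Cn)                 ≤⟨ +-cancelˡ-≤ (suc n * Cn) _ _ (begin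
    suc s * (suc n * Cn)             ≤⟨ *-monoʳ-≤ (suc s) subtracted ⟩
    suc s * (suc n * Cm + tk * Cn)   ≡⟨ *-distribˡ-+ (suc s) (suc n * Cm) (tk * Cn) ⟩
    suc s * (suc n * Cm) + suc s * (tk * Cn)
      ≤⟨ +-monoʳ-≤ (suc s * (suc n * Cm)) (≤-trans (≤-reflexive (x∙yz≈yx∙z (suc s) tk Cn)) (*-monoˡ-≤ Cn hyp)) ⟩
    suc s * (suc n * Cm) + suc n * Cn ≡⟨ +-comm _ (suc n * Cn) ⟩
    suc n * Cn + suc s * (suc n * Cm) ∎) ⟩
  suc s * (suc n * Cm)             ≡⟨ x∙yz≈y∙xz (suc s) (suc n) Cm ⟩
  suc n * (suc s * Cm)             ∎)
  where
  open ≤-Reasoning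
  Cn = suc n C suc j
  Cm = (suc n ∸ t) C suc j
  tk = t * suc j
  subtracted : suc n * Cn ≤ suc n * Cm + tk * Cn
  subtracted = begin
    suc n * Cn                        ≤⟨ *-monoʳ-≤ (suc n) (nC[1+j]≤[n-t]C[1+j]+t*[n-1]Cj (suc n) j t) ⟩
    suc n * (Cm + t * (n C j))        ≡⟨ *-distribˡ-+ (suc n) Cm (t * (n C j)) ⟩
    suc n * Cm + suc n * (t * (n C j)) ≡⟨ cong (suc n * Cm +_) (x∙yz≈y∙xz (suc n) t (n C j)) ⟩
    suc n * Cm + t * (suc n * (n C j)) ≡⟨ cong (λ z → suc n * Cm + t * z) ([1+n]*nCj≡[1+j]*[1+n]C[1+j] n j) ⟩
    suc n * Cm + t * (suc j * Cn)     ≡⟨ cong (suc n * Cm +_) (*-assoc t (suc j) Cn) ⟨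
    suc n * Cm + tk * Cn              ∎

-- Choosing the number of unit vectors

^-distribʳ-* : ∀ m n o → (m * n) ^ o ≡ m ^ o * n ^ o
^-distribʳ-* m n zero = refl
^-distribʳ-* m n (suc o) = trans (cong (m * n *_) (^-distribʳ-* m n o)) (interchange* m n (m ^ o) (n ^ o))
  where
  interchange* : ∀ a b c d → a * b * (c * d) ≡ a * c * (b * d)
  interchange* = solve-∀

m*m≤n*n⇒m≤n : ∀ {m n} → m * m ≤ n * n → m ≤ n
m*m≤n*n⇒m≤n {m} {n} m²≤n² = decidable-stable (m ≤? n) λ m≰n → <⇒≱ (*-mono-< (≰⇒> m≰n) (≰⇒> m≰n)) m²≤n²

n^e≤t^[1+e] : ∀ {n c t} e .{{_ : NonZero n}} → n ≤ c * t → c ^ suc e ≤ n → n ^ e ≤ t ^ suc e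
n^e≤t^[1+e] {n} {c} {t} e n≤ct c^≤n = *-cancelˡ-≤ n (begin
  n * n ^ e               ≤⟨ ^-monoˡ-≤ (suc e) n≤ct ⟩
  (c * t) ^ suc e         ≡⟨ ^-distribʳ-* c t (suc e) ⟩
  c ^ suc e * t ^ suc e   ≤⟨ *-monoˡ-≤ (t ^ suc e) c^≤n ⟩
  n * t ^ suc e           ∎)
  where open ≤-Reasoning

n^[r*a]≤[t^b]^[1+r] : ∀ {n t} r a b .{{_ : NonZero n}} → (r + r) * a ≤ suc (r + r) * b →
                   n ^ suc (r + r) ≤ t ^ suc (suc (r + r)) → n ^ (r * a) ≤ (t ^ b) ^ suc r
n^[r*a]≤[t^b]^[1+r] {n} {t} r a b 2ra≤ n^≤t^ = m*m≤n*n⇒m≤n (begin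
  n ^ (r * a) * n ^ (r * a)          ≡⟨ ^-distribˡ-+-* n (r * a) (r * a) ⟨
  n ^ (r * a + r * a)                ≡⟨ cong (n ^_) (*-distribʳ-+ a r r) ⟨
  n ^ ((r + r) * a)                  ≤⟨ ^-monoʳ-≤ n 2ra≤ ⟩
  n ^ (suc (r + r) * b)              ≡⟨ ^-*-assoc n (suc (r + r)) b ⟨
  (n ^ suc (r + r)) ^ b              ≤⟨ ^-monoˡ-≤ b n^≤t^ ⟩
  (t ^ suc (suc (r + r))) ^ b        ≡⟨ ^-*-assoc t (suc (suc (r + r))) b ⟩
  t ^ (suc (suc (r + r)) * b)        ≡⟨ cong (t ^_) (double r b) ⟩
  t ^ (b * suc r + b * suc r)        ≡⟨ ^-distribˡ-+-* t (b * suc r) (b * suc r) ⟩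
  t ^ (b * suc r) * t ^ (b * suc r)  ≡⟨ cong₂ _*_ (^-*-assoc t b (suc r)) (^-*-assoc t b (suc r)) ⟨
  (t ^ b) ^ suc r * (t ^ b) ^ suc r  ∎)
  where
  open ≤-Reasoning
  double : ∀ r b → suc (suc (r + r)) * b ≡ b * suc r + b * suc r
  double = solve-∀

quotient-bounds : ∀ n D .{{_ : NonZero D}} → D ≤ n → n / D * D ≤ n × n ≤ 2 * D * (n / D)
quotient-bounds n D D≤n = m/n*n≤m n D , (begin
  n                     ≡⟨ m≡m%n+[m/n]*n n D ⟩
  n % D + t * D         ≤⟨ +-monoˡ-≤ (t * D) (<⇒≤ (m%n<n n D)) ⟩
  D + t * D             ≤⟨ +-monoˡ-≤ (t * D) (m≤m*n D t {{>-nonZero 1≤t}}) ⟩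
  D * t + t * D         ≡⟨ twice D t ⟩
  2 * D * t             ∎)
  where
  open ≤-Reasoning
  t = n / D
  1≤t : 1 ≤ t
  1≤t = m≥n⇒m/n>0 D≤n
  twice : ∀ D t → D * t + t * D ≡ 2 * D * t
  twice = solve-∀

n^[r*nCk]≤IndMat^[1+r] : ∀ n k r → (2 * suc (r + r) * suc k) ^ suc (suc (r + r)) ≤ n →
                         n ^ (r * (n C k)) ≤ IndMat n k ^ suc r
n^[r*nCk]≤IndMat^[1+r] n k r big = begin
  n ^ (r * (n C k))             ≤⟨ n^[r*a]≤[t^b]^[1+r] r (n C k) ((n ∸ t) C k) ratio traded ⟩
  (t ^ ((n ∸ t) C k)) ^ suc r   ≤⟨ ^-monoˡ-≤ (suc r) matchings ⟩
  IndMat n k ^ suc r            ∎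
  where
  open ≤-Reasoning
  s = r + r
  D = suc k * suc s
  big′ : (2 * D) ^ suc (suc s) ≤ n
  big′ = subst (λ x → x ^ suc (suc s) ≤ n) (reassociate k s) big
    where
    reassociate : ∀ k s → 2 * suc s * suc k ≡ 2 * (suc k * suc s)
    reassociate = solve-∀
  D≤n : D ≤ n
  D≤n = ≤-trans (m≤n*m D 2) (≤-trans (m≤m*n (2 * D) ((2 * D) ^ suc s) {{m^n≢0 (2 * D) (suc s)}}) big′)
  instance
    n≢0 : NonZero n
    n≢0 = >-nonZero (≤-trans (s≤s z≤n) D≤n)
  t = n / D
  bounds : t * D ≤ n × n ≤ 2 * D * t
  bounds = quotient-bounds n D D≤n
  ratio : s * (n C k) ≤ suc s * ((n ∸ t) C k)
  ratio = s*nCk≤[1+s]*[n-t]Ck n k t s (begin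
    t * k * suc s      ≡⟨ *-assoc t k (suc s) ⟩
    t * (k * suc s)    ≤⟨ *-monoʳ-≤ t (*-monoˡ-≤ (suc s) (n≤1+n k)) ⟩
    t * D              ≤⟨ proj₁ bounds ⟩
    n                  ∎)
  traded : n ^ suc s ≤ t ^ suc (suc s)
  traded = n^e≤t^[1+e] (suc s) (proj₂ bounds) big′
  matchings : t ^ ((n ∸ t) C k) ≤ IndMat n k
  matchings = subst (λ x → t ^ ((n ∸ t) C k) ≤ IndMat x k) (m∸n+n≡m t≤n) (t^[mCk]≤IndMat[m+t] (n ∸ t) t k)
    where
    t≤n : t ≤ n
    t≤n = ≤-trans (m≤m*n t D) (proj₁ bounds)

Eventually : (ℕ → Set) → Set
Eventually P = ∃[ N ] (∀ n → N ≤ n → P n)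

eventually-map : ∀ {P Q : ℕ → Set} → (∀ {n} → P n → Q n) → Eventually P → Eventually Q
eventually-map f (N , p) = N , λ n N≤n → f (p n N≤n)

eventually-× : ∀ {P Q : ℕ → Set} → Eventually P → Eventually Q → Eventually (λ n → P n × Q n)
eventually-× (N , p) (N′ , q) =
  N ⊔ N′ , λ n N⊔N′≤n → p n (m⊔n≤o⇒m≤o N N′ N⊔N′≤n) , q n (m⊔n≤o⇒n≤o N N′ N⊔N′≤n)

-- Either k n ≤ (2c)^E, a constant, or else (c·(k n + 1))^E ≤ (2c)^E·(k n)^E ≤ (k n)^(E+1).
scaled-powers-eventually : (k : ℕ → ℕ) → (∀ q → 1 ≤ q → Eventually (λ n → k n ^ q ≤ n)) →
                           ∀ c E → Eventually (λ n → (c * suc (k n)) ^ E ≤ n)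
scaled-powers-eventually k k-small c E =
  eventually-map (λ (k^≤n , bound≤n) → bounded k^≤n bound≤n)
    (eventually-× (k-small (suc E) (s≤s z≤n)) (bound , λ _ → id))
  where
  c₀ = (2 * c) ^ E
  bound = (c * suc c₀) ^ E
  bounded : ∀ {n} → k n ^ suc E ≤ n → bound ≤ n → (c * suc (k n)) ^ E ≤ n
  bounded {n} k^≤n bound≤n with k n ≤? c₀
  ... | yes k≤c₀ = ≤-trans (^-monoˡ-≤ E (*-monoʳ-≤ c (s≤s k≤c₀))) bound≤n
  ... | no k≰c₀ = begin
    (c * suc (k n)) ^ E     ≤⟨ ^-monoˡ-≤ E (*-monoʳ-≤ c 1+k≤2k) ⟩
    (c * (2 * k n)) ^ E     ≡⟨ cong (_^ E) (*-assoc-2 c (k n)) ⟩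
    (2 * c * k n) ^ E       ≡⟨ ^-distribʳ-* (2 * c) (k n) E ⟩
    c₀ * k n ^ E            ≤⟨ *-monoˡ-≤ (k n ^ E) (<⇒≤ (≰⇒> k≰c₀)) ⟩
    k n ^ suc E             ≤⟨ k^≤n ⟩
    n                       ∎
    where
    open ≤-Reasoning
    1+k≤2k : suc (k n) ≤ 2 * k n
    1+k≤2k = ≤-trans (≤-reflexive (+-comm 1 (k n)))
      (+-monoʳ-≤ (k n) (≤-trans (≤-trans (s≤s z≤n) (≰⇒> k≰c₀)) (≤-reflexive (sym (+-identityʳ (k n))))))
    *-assoc-2 : ∀ c x → c * (2 * x) ≡ 2 * c * x
    *-assoc-2 = solve-∀

proposition2p1 : (k : ℕ → ℕ)
    → (∀ q → 1 ≤ q → ∃[ N ] (∀ n → N ≤ n → k n ^ q ≤ n))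
    → ∀ q → 1 ≤ q → ∃[ N ] (∀ n → N ≤ n →
        (IndMat n (k n) ≤ m n (k n))
        × (n ^ ((q ∸ 1) * (n C k n)) ≤ IndMat n (k n) ^ q))
proposition2p1 k k-small (suc r) _ =
  eventually-map (λ {n} (k≤n , large) → IndMat≤m k≤n , n^[r*nCk]≤IndMat^[1+r] n (k n) r large)
    (eventually-× (eventually-map (≤-trans (≤-reflexive (sym (*-identityʳ _)))) (k-small 1 (s≤s z≤n)))
                  (scaled-powers-eventually k k-small (2 * suc (r + r)) (suc (suc (r + r)))))
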